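{- A flipped regular graph is identified by $C^2$ if and only if it has no edges, or it is a perfect matching, or it is a $5$-cycle.
   Context: Graphs are finite, undirected, without loops. $C^2$: $2$-variable first-order logic with counting quantifiers; a graph $G$ is identified by $C^2$ if some $C^2$-sentence holds in $G$ and only in graphs isomorphic to $G$. The $C^2$-partition of a graph is its coarsest equitable partition (for a regular graph this is the single class $V(G)$). For sets $P,Q$ let $[P,Q]=\{\{v,w\}:v\neq w,v\in P,w\in Q\}$. A graph $F$ is flipped if for all (not necessarily distinct) classes $P,Q$ of its $C^2$-partition, $|[P,Q]\cap E(F)|\le|[P,Q]\setminus E(F)|$. -}

module Defs where

open import Data.Bool using (Bool; true; false; T; if_then_else_; _∧_; _∨_; not)
open import Data.Nat using (ℕ; zero; suc; _+_; _≤_; _≤ᵇ_; _<ᵇ_; _≡ᵇ_)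
open import Data.Nat.DivMod using (_%_)
open import Data.Fin using (Fin; toℕ) renaming (zero to fz; suc to fs)
import Data.Fin as F
open import Data.Unit using (⊤; tt)
open import Data.Product using (Σ; ∃; _×_; _,_; proj₁; proj₂)
open import Data.Sum using (_⊎_)
open import Function using (_∘_)
open import Function.Bundles using (Inverse; _↔_; _⇔_)
open import Relation.Nullary.Decidable using (⌊_⌋)
open import Relation.Binary.PropositionalEquality using (_≡_; refl)
open import Data.Bool.Properties using (∨-comm)

countF : (n : ℕ) → (Fin n → Bool) → ℕ
countF zero    f = 0
countF (suc n) f = (if f fz then 1 else 0) + countF n (f ∘ fs)

sumF : (n : ℕ) → (Fin n → ℕ) → ℕ
sumF zero    f = 0
sumF (suc n) f = f fz + sumF n (f ∘ fs)

-- number of unordered pairs {i,j}, i ≠ j, satisfying R (counted via i < j)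
countPairs : (n : ℕ) → (Fin n → Fin n → Bool) → ℕ
countPairs n R = sumF n (λ i → countF n (λ j → (toℕ i <ᵇ toℕ j) ∧ R i j))

record Graph : Set where
  field
    n     : ℕ
    adj   : Fin n → Fin n → Bool
    sym   : ∀ i j → adj i j ≡ adj j i
    irrefl : ∀ i → adj i i ≡ false
open Graph public

deg : (G : Graph) → Fin (n G) → ℕ
deg G v = countF (n G) (adj G v)

Regular : Graph → Set
Regular G = ∃ λ d → ∀ v → deg G v ≡ d

NoEdges : Graph → Set
NoEdges G = ∀ v w → adj G v w ≡ false

PerfectMatching : Graph → Set
PerfectMatching G = ∀ v → deg G v ≡ 1

Iso : Graph → Graph → Set
Iso G H = Σ (Fin (n G) ↔ Fin (n H)) λ f →
  ∀ i j → adj G i j ≡ adj H (Inverse.to f i) (Inverse.to f j)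

c5adj : Fin 5 → Fin 5 → Bool
c5adj i j = ((toℕ i + 1) % 5 ≡ᵇ toℕ j) ∨ ((toℕ j + 1) % 5 ≡ᵇ toℕ i)

c5step : Fin 5 → Fin 5 → Bool
c5step i j = (toℕ i + 1) % 5 ≡ᵇ toℕ j

C5 : Graph
C5 = record
  { n = 5
  ; adj = λ i j → c5step i j ∨ c5step j i
  ; sym = λ i j → ∨-comm (c5step i j) (c5step j i)
  ; irrefl = irr
  }
  where
  irr : ∀ i → (c5step i i ∨ c5step i i) ≡ false
  irr fz = refl
  irr (fs fz) = refl
  irr (fs (fs fz)) = refl
  irr (fs (fs (fs fz))) = refl
  irr (fs (fs (fs (fs fz)))) = refl

-- Formulas are indexed by which of
-- the two variables x, y are currently in scope (bound or assigned);
-- sentences are formulas with neither variable in scope.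

data Var : Set where
  vx vy : Var

InScope : Var → Bool → Bool → Set
InScope vx bx by = T bx
InScope vy bx by = T by

data Fm : Bool → Bool → Set where
  atE   : ∀ {bx by} (u v : Var) → InScope u bx by → InScope v bx by → Fm bx by
  atEq  : ∀ {bx by} (u v : Var) → InScope u bx by → InScope v bx by → Fm bx by
  neg   : ∀ {bx by} → Fm bx by → Fm bx by
  conj  : ∀ {bx by} → Fm bx by → Fm bx by → Fm bx by
  cntx  : ∀ {bx by} → ℕ → Fm true by → Fm bx by
  cnty  : ∀ {bx by} → ℕ → Fm bx true → Fm bx by

Sentence : Set
Sentence = Fm false false

Slot : ℕ → Bool → Set
Slot m true  = Fin m
Slot m false = ⊤

getSlot : ∀ {m} (b : Bool) → T b → Slot m b → Fin m
getSlot true _ s = s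

Env : ℕ → Bool → Bool → Set
Env m bx by = Slot m bx × Slot m by

lookupV : ∀ {m bx by} (u : Var) → InScope u bx by → Env m bx by → Fin m
lookupV {bx = bx} vx p ρ = getSlot bx p (proj₁ ρ)
lookupV {by = by} vy p ρ = getSlot by p (proj₂ ρ)

eval : (G : Graph) → ∀ {bx by} → Fm bx by → Env (n G) bx by → Bool
eval G (atE u v p q) ρ  = adj G (lookupV u p ρ) (lookupV v q ρ)
eval G (atEq u v p q) ρ = ⌊ lookupV u p ρ F.≟ lookupV v q ρ ⌋
eval G (neg φ) ρ        = not (eval G φ ρ)
eval G (conj φ ψ) ρ     = eval G φ ρ ∧ eval G ψ ρ
eval G (cntx k φ) ρ     = k ≤ᵇ countF (n G) (λ w → eval G φ (w , proj₂ ρ))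
eval G (cnty k φ) ρ     = k ≤ᵇ countF (n G) (λ w → eval G φ (proj₁ ρ , w))

_⊨_ : Graph → Sentence → Set
G ⊨ φ = T (eval G φ (tt , tt))

IdentifiedC2 : Graph → Set
IdentifiedC2 G = Σ Sentence λ φ → (G ⊨ φ) × (∀ H → H ⊨ φ → Iso G H)

-- Equitable partitions, the C²-partition, flipped graphs.
-- A partition into (at most) k classes is given by a colouring
-- c : Fin n → Fin k; its classes are the non-empty fibres.

nbrsIn : (G : Graph) {k : ℕ} → (Fin (n G) → Fin k) → Fin (n G) → Fin k → ℕ
nbrsIn G c v j = countF (n G) (λ w → adj G v w ∧ ⌊ c w F.≟ j ⌋)

Equitable : (G : Graph) {k : ℕ} → (Fin (n G) → Fin k) → Set
Equitable G c = ∀ v w → c v ≡ c w → ∀ j → nbrsIn G c v j ≡ nbrsIn G c w j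

CoarsestEquitable : (G : Graph) {k : ℕ} → (Fin (n G) → Fin k) → Set
CoarsestEquitable G c =
  Equitable G c ×
  (∀ {k'} (c' : Fin (n G) → Fin k') → Equitable G c' → ∀ v w → c' v ≡ c' w → c v ≡ c w)

inPQ : ∀ {m k} → (Fin m → Fin k) → Fin k → Fin k → Fin m → Fin m → Bool
inPQ c p q v w = (⌊ c v F.≟ p ⌋ ∧ ⌊ c w F.≟ q ⌋) ∨ (⌊ c v F.≟ q ⌋ ∧ ⌊ c w F.≟ p ⌋)

Flipped : Graph → Set
Flipped G = ∀ {k} (c : Fin (n G) → Fin k) → CoarsestEquitable G c → ∀ p q →
  countPairs (n G) (λ v w → inPQ c p q v w ∧ adj G v w)
    ≤ countPairs (n G) (λ v w → inPQ c p q v w ∧ not (adj G v w))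

-- In a regular graph the C²-partition is trivial, and by induction on formulas the truth of a C²-formula in a
-- d-regular graph on n vertices depends only on the atomic type (equal, adjacent, neither) of the assigned
-- vertices. So G is identified iff it is the only d-regular graph on n vertices up to isomorphism, which holds
-- for d = 0, for d = 1 and for C5. Otherwise being flipped gives 2d + 1 ≤ n, the handshake lemma excludes n and
-- d both odd, and a 2-switch of a circulant (bipartite if n is even, the cycle if d = 2, C_n(1, …, k) if
-- d = 2k ≥ 4) yields a second d-regular graph on n vertices that differs from it in its triangles.

module Submission where

open import Defs renaming (sym to adj-sym)
open import Data.Bool using (Bool; true; false; if_then_else_; _∧_; _∨_; not; T; _xor_)
import Data.Bool as Bool
open import Data.Bool.Properties
  using (∧-identityʳ; ∧-zeroʳ; ∧-comm; ∨-comm; ∨-identityʳ; ∨-zeroʳ; xor-identityʳ; not-¬; not-involutive; ¬-not; T-≡; T-∧)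
open import Data.Nat using (ℕ; zero; suc; pred; _+_; _*_; _∸_; _≤_; _<_; z≤n; s≤s; _<ᵇ_; _≤ᵇ_; _<?_; NonZero)
import Data.Nat as ℕ
open import Data.Nat.Properties
open import Algebra.Properties.CommutativeSemigroup +-commutativeSemigroup using (interchange; x∙yz≈y∙xz; xy∙z≈zy∙x)
open import Data.Nat.DivMod using (_%_; m<n⇒m%n≡m; [m+n]%n≡m%n; %-distribˡ-+; m%n%n≡m%n; m%n<n; n%n≡0)
open import Data.Nat.Tactic.RingSolver using (solve-∀)
open import Data.Fin using (Fin; toℕ; fromℕ<; #_; punchIn; _↑ˡ_; _↑ʳ_) renaming (zero to fz; suc to fs)
import Data.Fin as F
import Data.Fin.Properties as FP
open import Data.Fin.Patterns
open import Data.Fin.Permutation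
  using (Permutation; permutation; _⟨$⟩ʳ_; _⟨$⟩ˡ_; inverseˡ; inverseʳ; _∘ₚ_; flip; lift₀; transpose; remove; punchIn-permute; ↔⇒≡; cast-id)
import Data.Fin.Permutation as Perm
import Data.Fin.Permutation.Components as PC
open import Data.Vec using (Vec; []; _∷_; lookup)
import Data.Vec as Vec
open import Data.Empty using (⊥; ⊥-elim)
open import Data.Unit using (⊤; tt)
open import Data.Product using (Σ; ∃; _×_; _,_; proj₁; proj₂)
open import Data.Sum using (_⊎_; inj₁; inj₂; [_,_])
open import Function using (_∘_)
open import Function.Bundles using (Equivalence; _⇔_; mk⇔)
open import Relation.Nullary using (¬_; yes; no; Dec)
open import Relation.Nullary.Decidable using (⌊_⌋; dec-true; dec-false; map′; _×-dec_; _→-dec_; toWitness)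
open import Relation.Binary.PropositionalEquality hiding ([_])

≤ᵇ-true : ∀ {m n} → m ≤ n → (m ≤ᵇ n) ≡ true
≤ᵇ-true m≤n = Equivalence.to T-≡ (≤⇒≤ᵇ m≤n)

≤ᵇ-false : ∀ {m n} → n < m → (m ≤ᵇ n) ≡ false
≤ᵇ-false {m} {n} n<m with m ≤ᵇ n in e
... | false = refl
... | true  = ⊥-elim (<⇒≱ n<m (≤ᵇ⇒≤ m n (Equivalence.from T-≡ e)))

≤ᵇ≡true⇒≤ : ∀ m n → (m ≤ᵇ n) ≡ true → m ≤ n
≤ᵇ≡true⇒≤ m n e = ≤ᵇ⇒≤ m n (Equivalence.from T-≡ e)

∨≡true : ∀ {a b} → a ∨ b ≡ true → a ≡ true ⊎ b ≡ true
∨≡true {true}  _ = inj₁ refl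
∨≡true {false} e = inj₂ e

𝟙 : Bool → ℕ
𝟙 b = if b then 1 else 0

true≢false : ¬ true ≡ false
true≢false ()

_≟ᵇ_ : ∀ {m} → Fin m → Fin m → Bool
i ≟ᵇ j = ⌊ i F.≟ j ⌋

≟ᵇ-refl : ∀ {m} (i : Fin m) → (i ≟ᵇ i) ≡ true
≟ᵇ-refl i with i F.≟ i
... | yes _ = refl
... | no i≢i = ⊥-elim (i≢i refl)

≟ᵇ-≢ : ∀ {m} {i j : Fin m} → ¬ i ≡ j → (i ≟ᵇ j) ≡ false
≟ᵇ-≢ {i = i} {j} i≢j with i F.≟ j
... | yes i≡j = ⊥-elim (i≢j i≡j)
... | no _ = refl

≟ᵇ⇒≡ : ∀ {m} {i j : Fin m} → (i ≟ᵇ j) ≡ true → i ≡ j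
≟ᵇ⇒≡ {i = i} {j} e with i F.≟ j
... | yes i≡j = i≡j

≟ᵇ-sym : ∀ {m} (i j : Fin m) → (i ≟ᵇ j) ≡ (j ≟ᵇ i)
≟ᵇ-sym i j with j F.≟ i
... | yes refl = ≟ᵇ-refl i
... | no j≢i = ≟ᵇ-≢ (≢-sym j≢i)

countF-cong : ∀ n {f g : Fin n → Bool} → (∀ i → f i ≡ g i) → countF n f ≡ countF n g
countF-cong zero    f≗g = refl
countF-cong (suc n) f≗g = cong₂ (λ b c → 𝟙 b + c) (f≗g fz) (countF-cong n (f≗g ∘ fs))

countF-false : ∀ n {f : Fin n → Bool} → (∀ i → f i ≡ false) → countF n f ≡ 0
countF-false zero    f≗0 = refl
countF-false (suc n) f≗0 rewrite f≗0 fz = countF-false n (f≗0 ∘ fs)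

countF-true : ∀ n {f : Fin n → Bool} → (∀ i → f i ≡ true) → countF n f ≡ n
countF-true zero    f≗1 = refl
countF-true (suc n) f≗1 rewrite f≗1 fz = cong suc (countF-true n (f≗1 ∘ fs))

countF≡0⇒false : ∀ n (f : Fin n → Bool) → countF n f ≡ 0 → ∀ i → f i ≡ false
countF≡0⇒false (suc n) f c≡0 i with f fz in f0
countF≡0⇒false (suc n) f c≡0 fz     | false = f0
countF≡0⇒false (suc n) f c≡0 (fs i) | false = countF≡0⇒false n (f ∘ fs) c≡0 i

countF>0⇒∃ : ∀ n (f : Fin n → Bool) → 0 < countF n f → ∃ λ i → f i ≡ true
countF>0⇒∃ (suc n) f c>0 with f fz in f0
... | true  = fz , f0
... | false with countF>0⇒∃ n (f ∘ fs) c>0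
...   | i , fi = fs i , fi

countF≤n : ∀ n (f : Fin n → Bool) → countF n f ≤ n
countF≤n zero    f = z≤n
countF≤n (suc n) f with f fz
... | true  = s≤s (countF≤n n (f ∘ fs))
... | false = m≤n⇒m≤1+n (countF≤n n (f ∘ fs))

countF-+ : ∀ n (f g h : Fin n → Bool) → (∀ i → 𝟙 (f i) ≡ 𝟙 (g i) + 𝟙 (h i)) →
  countF n f ≡ countF n g + countF n h
countF-+ zero    f g h split = refl
countF-+ (suc n) f g h split = begin
  𝟙 (f fz) + countF n (f ∘ fs)
    ≡⟨ cong₂ _+_ (split fz) (countF-+ n (f ∘ fs) (g ∘ fs) (h ∘ fs) (split ∘ fs)) ⟩
  (𝟙 (g fz) + 𝟙 (h fz)) + (countF n (g ∘ fs) + countF n (h ∘ fs))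
    ≡⟨ interchange (𝟙 (g fz)) _ _ _ ⟩
  (𝟙 (g fz) + countF n (g ∘ fs)) + (𝟙 (h fz) + countF n (h ∘ fs)) ∎
  where open ≡-Reasoning

countF-not : ∀ n (f : Fin n → Bool) → countF n f + countF n (not ∘ f) ≡ n
countF-not n f = trans (sym (countF-+ n (λ _ → true) f (not ∘ f) split)) (countF-true n λ _ → refl)
  where
  split : ∀ i → 1 ≡ 𝟙 (f i) + 𝟙 (not (f i))
  split i with f i
  ... | true  = refl
  ... | false = refl

countF-∧ʳ : ∀ n (f : Fin n → Bool) b → countF n (λ i → f i ∧ b) ≡ (if b then countF n f else 0)
countF-∧ʳ n f true  = countF-cong n (λ i → ∧-identityʳ (f i))
countF-∧ʳ n f false = countF-false n (λ i → ∧-zeroʳ (f i))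

countF-≟ : ∀ n (i : Fin n) (f : Fin n → Bool) → countF n (λ j → (i ≟ᵇ j) ∧ f j) ≡ 𝟙 (f i)
countF-≟ (suc n) fz f = trans (cong (𝟙 (f fz) +_) (countF-false n (λ _ → refl))) (+-identityʳ _)
countF-≟ (suc n) (fs i) f = trans (countF-cong n (λ j → cong (_∧ f (fs j)) (shift j))) (countF-≟ n i (f ∘ fs))
  where
  shift : ∀ j → (fs i ≟ᵇ fs j) ≡ (i ≟ᵇ j)
  shift j with i F.≟ j
  ... | yes _ = refl
  ... | no _ = refl

countF-punchIn : ∀ n (f : Fin (suc n) → Bool) k → countF (suc n) f ≡ 𝟙 (f k) + countF n (f ∘ punchIn k)
countF-punchIn n f fz = refl
countF-punchIn (suc n) f (fs k) = begin
  𝟙 (f fz) + countF (suc n) (f ∘ fs)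
    ≡⟨ cong (𝟙 (f fz) +_) (countF-punchIn n (f ∘ fs) k) ⟩
  𝟙 (f fz) + (𝟙 (f (fs k)) + countF n (f ∘ fs ∘ punchIn k))
    ≡⟨ x∙yz≈y∙xz (𝟙 (f fz)) (𝟙 (f (fs k))) _ ⟩
  𝟙 (f (fs k)) + (𝟙 (f fz) + countF n (f ∘ fs ∘ punchIn k)) ∎
  where open ≡-Reasoning

countF-∋⇒≥1 : ∀ n (f : Fin n → Bool) j → f j ≡ true → 1 ≤ countF n f
countF-∋⇒≥1 (suc n) f j fj = begin
  1                                   ≤⟨ m≤m+n 1 _ ⟩
  1 + countF n (f ∘ punchIn j)        ≡⟨ cong (λ b → 𝟙 b + countF n (f ∘ punchIn j)) fj ⟨
  𝟙 (f j) + countF n (f ∘ punchIn j)  ≡⟨ countF-punchIn n f j ⟨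
  countF (suc n) f                    ∎
  where open ≤-Reasoning

countF≡1⇒unique : ∀ n (f : Fin n → Bool) → countF n f ≡ 1 → ∀ i j → f i ≡ true → f j ≡ true → i ≡ j
countF≡1⇒unique (suc n) f c≡1 i j fi fj with i F.≟ j
... | yes i≡j = i≡j
... | no i≢j = ⊥-elim (1+n≰n (begin
  2                                   ≤⟨ s≤s (countF-∋⇒≥1 n (f ∘ punchIn i) (F.punchOut i≢j)
                                                (trans (cong f (FP.punchIn-punchOut i≢j)) fj)) ⟩
  1 + countF n (f ∘ punchIn i)        ≡⟨ cong (λ b → 𝟙 b + countF n (f ∘ punchIn i)) fi ⟨
  𝟙 (f i) + countF n (f ∘ punchIn i)  ≡⟨ countF-punchIn n f i ⟨
  countF (suc n) f                    ≡⟨ c≡1 ⟩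
  1                                   ∎))
  where open ≤-Reasoning

countF-perm : ∀ m n (π : Permutation m n) (f : Fin n → Bool) → countF m (f ∘ (π ⟨$⟩ʳ_)) ≡ countF n f
countF-perm zero    zero    π f = refl
countF-perm zero    (suc n) π f = ⊥-elim (FP.¬Fin0 (π ⟨$⟩ˡ fz))
countF-perm (suc m) zero    π f = ⊥-elim (FP.¬Fin0 (π ⟨$⟩ʳ fz))
countF-perm (suc m) (suc n) π f = begin
  𝟙 (f (π ⟨$⟩ʳ fz)) + countF m (λ i → f (π ⟨$⟩ʳ fs i))
    ≡⟨ cong (𝟙 (f (π ⟨$⟩ʳ fz)) +_) (countF-cong m (λ i → cong f (punchIn-permute π fz i))) ⟩
  𝟙 (f (π ⟨$⟩ʳ fz)) + countF m (λ i → f (punchIn (π ⟨$⟩ʳ fz) (remove fz π ⟨$⟩ʳ i)))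
    ≡⟨ cong (𝟙 (f (π ⟨$⟩ʳ fz)) +_) (countF-perm m n (remove fz π) (f ∘ punchIn (π ⟨$⟩ʳ fz))) ⟩
  𝟙 (f (π ⟨$⟩ʳ fz)) + countF n (f ∘ punchIn (π ⟨$⟩ʳ fz))
    ≡⟨ countF-punchIn n f (π ⟨$⟩ʳ fz) ⟨
  countF (suc n) f ∎
  where open ≡-Reasoning

countF-↑ : ∀ m n (f : Fin (m + n) → Bool) → countF (m + n) f ≡ countF m (f ∘ (_↑ˡ n)) + countF n (f ∘ (m ↑ʳ_))
countF-↑ zero    n f = refl
countF-↑ (suc m) n f = trans (cong (𝟙 (f fz) +_) (countF-↑ m n (f ∘ fs))) (sym (+-assoc (𝟙 (f fz)) _ _))

countF-<ᵇ : ∀ n k → k ≤ n → countF n (λ i → toℕ i <ᵇ k) ≡ k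
countF-<ᵇ zero    zero    z≤n = refl
countF-<ᵇ (suc n) zero    _ = countF-false (suc n) (λ _ → refl)
countF-<ᵇ (suc n) (suc k) (s≤s k≤n) = cong suc (countF-<ᵇ n k k≤n)

sumF-cong : ∀ n {f g : Fin n → ℕ} → (∀ i → f i ≡ g i) → sumF n f ≡ sumF n g
sumF-cong zero    f≗g = refl
sumF-cong (suc n) f≗g = cong₂ _+_ (f≗g fz) (sumF-cong n (f≗g ∘ fs))

sumF-const : ∀ n c → sumF n (λ _ → c) ≡ n * c
sumF-const zero    c = refl
sumF-const (suc n) c = cong (c +_) (sumF-const n c)

sumF-+ : ∀ n (f g : Fin n → ℕ) → sumF n (λ i → f i + g i) ≡ sumF n f + sumF n g
sumF-+ zero    f g = refl
sumF-+ (suc n) f g = begin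
  (f fz + g fz) + sumF n (λ i → f (fs i) + g (fs i))
    ≡⟨ cong ((f fz + g fz) +_) (sumF-+ n (f ∘ fs) (g ∘ fs)) ⟩
  (f fz + g fz) + (sumF n (f ∘ fs) + sumF n (g ∘ fs))
    ≡⟨ interchange (f fz) _ _ _ ⟩
  (f fz + sumF n (f ∘ fs)) + (g fz + sumF n (g ∘ fs)) ∎
  where open ≡-Reasoning

countF-as-sumF : ∀ n (f : Fin n → Bool) → countF n f ≡ sumF n (𝟙 ∘ f)
countF-as-sumF zero    f = refl
countF-as-sumF (suc n) f = cong (𝟙 (f fz) +_) (countF-as-sumF n (f ∘ fs))

sumF-countF-swap : ∀ n m (R : Fin n → Fin m → Bool) →
  sumF n (λ i → countF m (R i)) ≡ sumF m (λ j → countF n (λ i → R i j))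
sumF-countF-swap zero    m R = sym (trans (sumF-const m 0) (*-zeroʳ m))
sumF-countF-swap (suc n) m R = begin
  countF m (R fz) + sumF n (λ i → countF m (R (fs i)))
    ≡⟨ cong₂ _+_ (countF-as-sumF m (R fz)) (sumF-countF-swap n m (R ∘ fs)) ⟩
  sumF m (𝟙 ∘ R fz) + sumF m (λ j → countF n (λ i → R (fs i) j))
    ≡⟨ sumF-+ m _ _ ⟨
  sumF m (λ j → countF (suc n) (λ i → R i j)) ∎
  where open ≡-Reasoning

trichotomyᵇ : ∀ {m} (i j : Fin m) → 𝟙 (toℕ i <ᵇ toℕ j) + 𝟙 (toℕ j <ᵇ toℕ i) + 𝟙 (i ≟ᵇ j) ≡ 1
trichotomyᵇ fz     fz     = refl
trichotomyᵇ fz     (fs j) = refl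
trichotomyᵇ (fs i) fz     = refl
trichotomyᵇ (fs i) (fs j) with i F.≟ j | trichotomyᵇ i j
... | yes _ | e = e
... | no _  | e = e

-- Each ordered pair (i, j) is below, above or on the diagonal.
handshake : ∀ n (R : Fin n → Fin n → Bool) → (∀ i j → R i j ≡ R j i) →
  sumF n (λ i → countF n (R i)) ≡ countPairs n R + countPairs n R + countF n (λ i → R i i)
handshake n R R-sym = begin
  sumF n (λ i → countF n (R i))
    ≡⟨ sumF-cong n (λ i → countF-+ n (R i) (offDiag i) (λ j → (i ≟ᵇ j) ∧ R i j) (diagSplit i)) ⟩
  sumF n (λ i → countF n (offDiag i) + countF n (λ j → (i ≟ᵇ j) ∧ R i j))
    ≡⟨ sumF-+ n _ _ ⟩
  sumF n (λ i → countF n (offDiag i)) + sumF n (λ i → countF n (λ j → (i ≟ᵇ j) ∧ R i j))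
    ≡⟨ cong₂ _+_ (trans (sumF-cong n (λ i → countF-+ n (offDiag i) (above i) (below i) (triSplit i))) (sumF-+ n _ _))
                 (trans (sumF-cong n (λ i → countF-≟ n i (R i))) (sym (countF-as-sumF n (λ i → R i i)))) ⟩
  (countPairs n R + sumF n (λ i → countF n (below i))) + countF n (λ i → R i i)
    ≡⟨ cong (λ z → (countPairs n R + z) + countF n (λ i → R i i)) belowSum ⟩
  countPairs n R + countPairs n R + countF n (λ i → R i i) ∎
  where
  open ≡-Reasoning
  above below offDiag : Fin n → Fin n → Bool
  above i j = (toℕ i <ᵇ toℕ j) ∧ R i j
  below i j = (toℕ j <ᵇ toℕ i) ∧ R i j
  offDiag i j = above i j ∨ below i j
  diagSplit : ∀ i j → 𝟙 (R i j) ≡ 𝟙 (offDiag i j) + 𝟙 ((i ≟ᵇ j) ∧ R i j)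
  diagSplit i j with toℕ i <ᵇ toℕ j | toℕ j <ᵇ toℕ i | i ≟ᵇ j | R i j | trichotomyᵇ i j
  ... | true  | false | false | true  | _ = refl
  ... | true  | false | false | false | _ = refl
  ... | false | true  | false | true  | _ = refl
  ... | false | true  | false | false | _ = refl
  ... | false | false | true  | true  | _ = refl
  ... | false | false | true  | false | _ = refl
  ... | true  | true  | _     | r | ()
  ... | true  | false | true  | r | ()
  ... | false | true  | true  | r | ()
  ... | false | false | false | r | ()
  triSplit : ∀ i j → 𝟙 (offDiag i j) ≡ 𝟙 (above i j) + 𝟙 (below i j)
  triSplit i j with toℕ i <ᵇ toℕ j | toℕ j <ᵇ toℕ i | R i j | trichotomyᵇ i j
  ... | true  | true  | r     | ()
  ... | true  | false | true  | _ = refl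
  ... | true  | false | false | _ = refl
  ... | false | true  | true  | _ = refl
  ... | false | true  | false | _ = refl
  ... | false | false | r     | _ = refl
  belowSum : sumF n (λ i → countF n (below i)) ≡ countPairs n R
  belowSum = trans (sumF-countF-swap n n below)
                   (sumF-cong n (λ j → countF-cong n (λ i → cong ((toℕ j <ᵇ toℕ i) ∧_) (R-sym i j))))

-- Regular graphs of equal size and degree are C²-equivalent

countF-∧-uniform : ∀ m m' (P : Fin m → Bool) (Q : Fin m' → Bool) (f : Fin m → Bool) (g : Fin m' → Bool) →
  countF m P ≡ countF m' Q → (∀ w w' → P w ≡ true → Q w' ≡ true → f w ≡ g w') →
  countF m (λ w → P w ∧ f w) ≡ countF m' (λ w → Q w ∧ g w)
countF-∧-uniform m m' P Q f g P≡Q f≈g with countF m P in cP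
... | zero = trans (countF-false m (λ w → cong (_∧ f w) (countF≡0⇒false m P cP w)))
                   (sym (countF-false m' (λ w → cong (_∧ g w) (countF≡0⇒false m' Q (sym P≡Q) w))))
... | suc _ with countF>0⇒∃ m P (subst (0 <_) (sym cP) (s≤s z≤n)) | countF>0⇒∃ m' Q (subst (0 <_) P≡Q (s≤s z≤n))
...   | w₀ , Pw₀ | w₀' , Qw₀' = begin
  countF m (λ w → P w ∧ f w)     ≡⟨ countF-cong m (λ w → on P w λ Pw → f≈g w w₀' Pw Qw₀') ⟩
  countF m (λ w → P w ∧ g w₀')   ≡⟨ countF-∧ʳ m P (g w₀') ⟩
  (if g w₀' then countF m P else 0)   ≡⟨ cong (λ c → if g w₀' then c else 0) (trans cP P≡Q) ⟩
  (if g w₀' then countF m' Q else 0)  ≡⟨ countF-∧ʳ m' Q (g w₀') ⟨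
  countF m' (λ w → Q w ∧ g w₀')
    ≡⟨ countF-cong m' (λ w → on Q w λ Qw → trans (sym (f≈g w₀ w₀' Pw₀ Qw₀')) (f≈g w₀ w Pw₀ Qw)) ⟩
  countF m' (λ w → Q w ∧ g w)    ∎
  where
  open ≡-Reasoning
  on : ∀ {k} (R : Fin k → Bool) w {a b : Bool} → (R w ≡ true → a ≡ b) → R w ∧ a ≡ R w ∧ b
  on R w h with R w
  ... | true  = h refl
  ... | false = refl

nonNbr : (G : Graph) → Fin (n G) → Fin (n G) → Bool
nonNbr G y w = not (y ≟ᵇ w) ∧ not (adj G y w)

countF-around : (G : Graph) (y : Fin (n G)) (f : Fin (n G) → Bool) →
  countF (n G) f ≡ countF (n G) (λ w → (y ≟ᵇ w) ∧ f w) + countF (n G) (λ w → adj G y w ∧ f w)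
                   + countF (n G) (λ w → nonNbr G y w ∧ f w)
countF-around G y f =
  trans (countF-+ (n G) f (λ w → ((y ≟ᵇ w) ∨ adj G y w) ∧ f w) (λ w → nonNbr G y w ∧ f w)
                 (λ w → split₁ (y ≟ᵇ w) (adj G y w) (f w) (loopless w)))
        (cong (_+ countF (n G) (λ w → nonNbr G y w ∧ f w))
              (countF-+ (n G) _ (λ w → (y ≟ᵇ w) ∧ f w) (λ w → adj G y w ∧ f w)
                        (λ w → split₂ (y ≟ᵇ w) (adj G y w) (f w) (loopless w))))
  where
  loopless : ∀ w → (y ≟ᵇ w) ∧ adj G y w ≡ false
  loopless w with y F.≟ w
  ... | yes refl = irrefl G y
  ... | no _ = refl
  split₁ : ∀ p q r → p ∧ q ≡ false → 𝟙 r ≡ 𝟙 ((p ∨ q) ∧ r) + 𝟙 ((not p ∧ not q) ∧ r)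
  split₁ true  true  r     ()
  split₁ true  false true  _ = refl
  split₁ true  false false _ = refl
  split₁ false true  true  _ = refl
  split₁ false true  false _ = refl
  split₁ false false true  _ = refl
  split₁ false false false _ = refl
  split₂ : ∀ p q r → p ∧ q ≡ false → 𝟙 ((p ∨ q) ∧ r) ≡ 𝟙 (p ∧ r) + 𝟙 (q ∧ r)
  split₂ true  true  r     ()
  split₂ true  false true  _ = refl
  split₂ true  false false _ = refl
  split₂ false q     r     _ = refl

countF-nonNbr : (G : Graph) (d : ℕ) → (∀ v → deg G v ≡ d) → (y : Fin (n G)) →
  suc d + countF (n G) (nonNbr G y) ≡ n G
countF-nonNbr G d regular y = begin
  suc d + countF (n G) (nonNbr G y)
    ≡⟨ cong₂ (λ a b → suc a + b) (sym (regular y)) (countF-cong (n G) (λ w → sym (∧-identityʳ _))) ⟩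
  suc (deg G y) + countF (n G) (λ w → nonNbr G y w ∧ true)
    ≡⟨ cong₂ (λ a b → a + b + countF (n G) (λ w → nonNbr G y w ∧ true))
             (sym (countF-≟ (n G) y (λ _ → true))) (countF-cong (n G) (λ w → sym (∧-identityʳ _))) ⟩
  countF (n G) (λ w → (y ≟ᵇ w) ∧ true) + countF (n G) (λ w → adj G y w ∧ true) + countF (n G) (λ w → nonNbr G y w ∧ true)
    ≡⟨ countF-around G y (λ _ → true) ⟨
  countF (n G) (λ _ → true)
    ≡⟨ countF-true (n G) (λ _ → refl) ⟩
  n G ∎
  where open ≡-Reasoning

countF-uniform : ∀ m m' (f : Fin m → Bool) (g : Fin m' → Bool) → m ≡ m' → (∀ w w' → f w ≡ g w') →
  countF m f ≡ countF m' g
countF-uniform m .m f g refl f≈g = countF-cong m (λ w → f≈g w w)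

adj⇒≟ᵇ-false : (G : Graph) {a b : Fin (n G)} → adj G a b ≡ true → (a ≟ᵇ b) ≡ false
adj⇒≟ᵇ-false G {a} {b} e with a F.≟ b
... | yes refl = ⊥-elim (true≢false (trans (sym e) (irrefl G a)))
... | no _ = refl

nonNbr⇒ : (G : Graph) {y w : Fin (n G)} → nonNbr G y w ≡ true → ((y ≟ᵇ w) ≡ false) × (adj G y w ≡ false)
nonNbr⇒ G {y} {w} e with y ≟ᵇ w | adj G y w
nonNbr⇒ G () | true  | _
nonNbr⇒ G () | false | true
... | false | false = refl , refl

SameType : (G H : Graph) → Fin (n G) × Fin (n G) → Fin (n H) × Fin (n H) → Set
SameType G H (a , b) (a' , b') = ((a ≟ᵇ b) ≡ (a' ≟ᵇ b')) × (adj G a b ≡ adj H a' b')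

sameType-diag : ∀ G H (x : Fin (n G)) (x' : Fin (n H)) → SameType G H (x , x) (x' , x')
sameType-diag G H x x' = trans (≟ᵇ-refl x) (sym (≟ᵇ-refl x')) , trans (irrefl G x) (sym (irrefl H x'))

sameType-swap : ∀ G H {a b : Fin (n G)} {a' b' : Fin (n H)} →
  SameType G H (a , b) (a' , b') → SameType G H (b , a) (b' , a')
sameType-swap G H {a} {b} {a'} {b'} (eq , ad) =
  trans (≟ᵇ-sym b a) (trans eq (≟ᵇ-sym a' b')) , trans (adj-sym G b a) (trans ad (adj-sym H a' b'))

module RegularIndistinguishable (G H : Graph) (d : ℕ) (n≡ : n G ≡ n H)
  (regG : ∀ v → deg G v ≡ d) (regH : ∀ v → deg H v ≡ d) where

  -- Each of {y}, N(y) and V ∖ N[y] has the same size in G and in H.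
  countF-byType : (y : Fin (n G)) (y' : Fin (n H)) (f : Fin (n G) → Bool) (g : Fin (n H) → Bool) →
    (∀ w w' → SameType G H (y , w) (y' , w') → f w ≡ g w') → countF (n G) f ≡ countF (n H) g
  countF-byType y y' f g f≈g = begin
    countF (n G) f      ≡⟨ countF-around G y f ⟩
    _                   ≡⟨ cong₂ _+_ (cong₂ _+_ self nbrs) others ⟩
    _                   ≡⟨ countF-around H y' g ⟨
    countF (n H) g      ∎
    where
    open ≡-Reasoning
    self : countF (n G) (λ w → (y ≟ᵇ w) ∧ f w) ≡ countF (n H) (λ w → (y' ≟ᵇ w) ∧ g w)
    self = countF-∧-uniform (n G) (n H) _ _ f g
      (trans (countF-cong (n G) (λ w → sym (∧-identityʳ _))) (trans (countF-≟ (n G) y (λ _ → true))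
        (sym (trans (countF-cong (n H) (λ w → sym (∧-identityʳ _))) (countF-≟ (n H) y' (λ _ → true))))))
      λ w w' e e' → f≈g w w' (subst₂ (λ v v' → SameType G H (y , v) (y' , v')) (≟ᵇ⇒≡ e) (≟ᵇ⇒≡ e')
                                     (sameType-diag G H y y'))
    nbrs : countF (n G) (λ w → adj G y w ∧ f w) ≡ countF (n H) (λ w → adj H y' w ∧ g w)
    nbrs = countF-∧-uniform (n G) (n H) _ _ f g (trans (regG y) (sym (regH y')))
      λ w w' e e' → f≈g w w' (trans (adj⇒≟ᵇ-false G e) (sym (adj⇒≟ᵇ-false H e')) , trans e (sym e'))
    others : countF (n G) (λ w → nonNbr G y w ∧ f w) ≡ countF (n H) (λ w → nonNbr H y' w ∧ g w)
    others = countF-∧-uniform (n G) (n H) _ _ f g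
      (+-cancelˡ-≡ (suc d) _ _ (trans (countF-nonNbr G d regG y) (trans n≡ (sym (countF-nonNbr H d regH y')))))
      λ w w' e e' → f≈g w w' ( trans (proj₁ (nonNbr⇒ G e)) (sym (proj₁ (nonNbr⇒ H e')))
                             , trans (proj₂ (nonNbr⇒ G e)) (sym (proj₂ (nonNbr⇒ H e'))))

  Related : ∀ {bx by} → Env (n G) bx by → Env (n H) bx by → Set
  Related {true}  {true}  ρ σ = SameType G H ρ σ
  Related {true}  {false} _ _ = ⊤
  Related {false} {_}     _ _ = ⊤

  lookup-sameType : ∀ {bx by} (ρ : Env (n G) bx by) (σ : Env (n H) bx by) → Related ρ σ →
    ∀ u v (p : InScope u bx by) (q : InScope v bx by) →
    SameType G H (lookupV u p ρ , lookupV v q ρ) (lookupV u p σ , lookupV v q σ)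
  lookup-sameType {true}  {true}  (x , y) (x' , y') r vx vx _ _ = sameType-diag G H x x'
  lookup-sameType {true}  {true}  (x , y) (x' , y') r vx vy _ _ = r
  lookup-sameType {true}  {true}  (x , y) (x' , y') r vy vx _ _ = sameType-swap G H r
  lookup-sameType {true}  {true}  (x , y) (x' , y') r vy vy _ _ = sameType-diag G H y y'
  lookup-sameType {true}  {false} (x , _) (x' , _) r vx vx _ _ = sameType-diag G H x x'
  lookup-sameType {true}  {false} ρ σ r vx vy _ ()
  lookup-sameType {true}  {false} ρ σ r vy v  () _
  lookup-sameType {false} {true}  (_ , y) (_ , y') r vy vy _ _ = sameType-diag G H y y'
  lookup-sameType {false} {true}  ρ σ r vy vx _ ()
  lookup-sameType {false} {true}  ρ σ r vx v  () _
  lookup-sameType {false} {false} ρ σ r vx v  () _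
  lookup-sameType {false} {false} ρ σ r vy v  () _

  eval-agrees : ∀ {bx by} (φ : Fm bx by) ρ σ → Related ρ σ → eval G φ ρ ≡ eval H φ σ
  eval-agrees (atE u v p q)  ρ σ r = proj₂ (lookup-sameType ρ σ r u v p q)
  eval-agrees (atEq u v p q) ρ σ r = proj₁ (lookup-sameType ρ σ r u v p q)
  eval-agrees (neg φ)        ρ σ r = cong not (eval-agrees φ ρ σ r)
  eval-agrees (conj φ ψ)     ρ σ r = cong₂ _∧_ (eval-agrees φ ρ σ r) (eval-agrees ψ ρ σ r)
  eval-agrees {by = false} (cntx k φ) ρ σ r = cong (k ≤ᵇ_)
    (countF-uniform (n G) (n H) _ _ n≡ (λ w w' → eval-agrees φ (w , tt) (w' , tt) tt))
  eval-agrees {by = true}  (cntx k φ) (_ , y) (_ , y') r = cong (k ≤ᵇ_)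
    (countF-byType y y' _ _ (λ w w' t → eval-agrees φ (w , y) (w' , y') (sameType-swap G H t)))
  eval-agrees {bx = false} (cnty k φ) ρ σ r = cong (k ≤ᵇ_)
    (countF-uniform (n G) (n H) _ _ n≡ (λ w w' → eval-agrees φ (tt , w) (tt , w') tt))
  eval-agrees {bx = true}  (cnty k φ) (x , _) (x' , _) r = cong (k ≤ᵇ_)
    (countF-byType x x' _ _ (λ w w' t → eval-agrees φ (x , w) (x' , w') t))

⊨-regular : ∀ G H d → n G ≡ n H → (∀ v → deg G v ≡ d) → (∀ v → deg H v ≡ d) → ∀ φ → G ⊨ φ → H ⊨ φ
⊨-regular G H d n≡ regG regH φ = subst T (eval-agrees φ (tt , tt) (tt , tt) tt)
  where open RegularIndistinguishable G H d n≡ regG regH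

Iso-sym : ∀ G H → Iso G H → Iso H G
Iso-sym G H (π , π-adj) = flip π , λ i j →
  sym (trans (π-adj (π ⟨$⟩ˡ i) (π ⟨$⟩ˡ j)) (cong₂ (adj H) (inverseʳ π) (inverseʳ π)))

Iso-trans : ∀ G H K → Iso G H → Iso H K → Iso G K
Iso-trans G H K (π , π-adj) (τ , τ-adj) = π ∘ₚ τ , λ i j → trans (π-adj i j) (τ-adj (π ⟨$⟩ʳ i) (π ⟨$⟩ʳ j))

Iso⇒n≡ : ∀ G H → Iso G H → n G ≡ n H
Iso⇒n≡ G H (π , _) = ↔⇒≡ π

Iso⇒deg≡ : ∀ G H ((π , _) : Iso G H) v → deg G v ≡ deg H (π ⟨$⟩ʳ v)
Iso⇒deg≡ G H (π , π-adj) v = trans (countF-cong (n G) (π-adj v)) (countF-perm (n G) (n H) π (adj H (π ⟨$⟩ʳ v)))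

HasTriangle : Graph → Set
HasTriangle G = Σ (Fin (n G)) λ a → Σ (Fin (n G)) λ b → Σ (Fin (n G)) λ c →
  (adj G a b ≡ true) × (adj G b c ≡ true) × (adj G a c ≡ true)

TriangleFree : Graph → Set
TriangleFree G = ¬ HasTriangle G

EdgesInTriangles : Graph → Set
EdgesInTriangles G = ∀ a b → adj G a b ≡ true → ∃ λ w → (adj G a w ≡ true) × (adj G b w ≡ true)

HasEdgeOutsideTriangles : Graph → Set
HasEdgeOutsideTriangles G = Σ (Fin (n G)) λ a → Σ (Fin (n G)) λ b → (adj G a b ≡ true) ×
  (∀ w → adj G a w ≡ true → adj G b w ≡ true → ⊥)

HasTriangle-Iso : ∀ G H → Iso G H → HasTriangle G → HasTriangle H
HasTriangle-Iso G H (π , π-adj) (a , b , c , ab , bc , ac) =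
  π ⟨$⟩ʳ a , π ⟨$⟩ʳ b , π ⟨$⟩ʳ c , trans (sym (π-adj a b)) ab , trans (sym (π-adj b c)) bc , trans (sym (π-adj a c)) ac

HasEdgeOutsideTriangles-Iso : ∀ G H → Iso G H → HasEdgeOutsideTriangles G → HasEdgeOutsideTriangles H
HasEdgeOutsideTriangles-Iso G H (π , π-adj) (a , b , ab , lonely) =
  π ⟨$⟩ʳ a , π ⟨$⟩ʳ b , trans (sym (π-adj a b)) ab ,
  λ w aw bw → lonely (π ⟨$⟩ˡ w) (back a aw) (back b bw)
  where
  back : ∀ x {w} → adj H (π ⟨$⟩ʳ x) w ≡ true → adj G x (π ⟨$⟩ˡ w) ≡ true
  back x e = trans (π-adj x _) (trans (cong (adj H (π ⟨$⟩ʳ x)) (inverseʳ π)) e)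

triangle-≇ : ∀ G H → HasTriangle G → TriangleFree H → ¬ Iso G H
triangle-≇ G H t free iso = free (HasTriangle-Iso G H iso t)

edgesInTriangles-≇ : ∀ G H → EdgesInTriangles G → HasEdgeOutsideTriangles H → ¬ Iso G H
edgesInTriangles-≇ G H inTri lonelyEdge iso with HasEdgeOutsideTriangles-Iso H G (Iso-sym G H iso) lonelyEdge
... | a , b , ab , lonely with inTri a b ab
...   | w , aw , bw = lonely w aw bw

identified-regular-unique : ∀ {G d} → IdentifiedC2 G → (∀ v → deg G v ≡ d) →
  ∀ H → n G ≡ n H → (∀ v → deg H v ≡ d) → Iso G H
identified-regular-unique {G} {d} (φ , Gφ , onlyG) regG H n≡ regH = onlyG H (⊨-regular G H d n≡ regG regH φ Gφ)

record NonIsomorphicRegular (N d : ℕ) : Set where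
  field
    G₁ G₂ : Graph
    size₁ : n G₁ ≡ N
    size₂ : n G₂ ≡ N
    regular₁ : ∀ v → deg G₁ v ≡ d
    regular₂ : ∀ v → deg G₂ v ≡ d
    G₁≇G₂ : ¬ Iso G₁ G₂

identified⇒¬NonIsomorphicRegular : ∀ {G d} → IdentifiedC2 G → (∀ v → deg G v ≡ d) →
  ¬ NonIsomorphicRegular (n G) d
identified⇒¬NonIsomorphicRegular {G} idG regG pair =
  G₁≇G₂ (Iso-trans G₁ G G₂ (Iso-sym G G₁ (unique G₁ (sym size₁) regular₁)) (unique G₂ (sym size₂) regular₂))
  where
  open NonIsomorphicRegular pair
  unique = identified-regular-unique idG regG

degree-sum : (G : Graph) (d : ℕ) → (∀ v → deg G v ≡ d) →
  n G * d ≡ countPairs (n G) (adj G) + countPairs (n G) (adj G)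
degree-sum G d regular = begin
  n G * d                                                ≡⟨ sumF-const (n G) d ⟨
  sumF (n G) (λ _ → d)                                   ≡⟨ sumF-cong (n G) regular ⟨
  sumF (n G) (λ i → countF (n G) (adj G i))              ≡⟨ handshake (n G) (adj G) (adj-sym G) ⟩
  countPairs (n G) (adj G) + countPairs (n G) (adj G) + countF (n G) (λ i → adj G i i)
    ≡⟨ cong (countPairs (n G) (adj G) + countPairs (n G) (adj G) +_) (countF-false (n G) (irrefl G)) ⟩
  countPairs (n G) (adj G) + countPairs (n G) (adj G) + 0 ≡⟨ +-identityʳ _ ⟩
  countPairs (n G) (adj G) + countPairs (n G) (adj G)    ∎
  where open ≡-Reasoning

trivialColouring : (G : Graph) → Fin (n G) → Fin 1
trivialColouring G _ = fz

trivialColouring-coarsest : (G : Graph) (d : ℕ) → (∀ v → deg G v ≡ d) →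
  CoarsestEquitable G (trivialColouring G)
trivialColouring-coarsest G d regular = equitable , λ _ _ _ _ _ → refl
  where
  equitable : Equitable G (trivialColouring G)
  equitable v w _ fz = trans (countF-cong (n G) (λ u → ∧-identityʳ (adj G v u)))
    (trans (regular v) (sym (trans (countF-cong (n G) (λ u → ∧-identityʳ (adj G w u))) (regular w))))

-- In a regular graph the flipped condition for the single class says |E| ≤ |non-edges|.
flipped⇒2d<n : (G : Graph) (d : ℕ) → (∀ v → deg G v ≡ d) → Flipped G → Fin (n G) → suc (d + d) ≤ n G
flipped⇒2d<n G d regular flipped v = m≤o∸n⇒m+n≤o (suc d) d≤N (*-cancelˡ-≤ N ⦃ nonZero v ⦄ N*[1+d]≤N*[N∸d])
  where
  N = n G
  E = countPairs N (adj G)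
  Ē = countPairs N (λ v w → not (adj G v w))
  E≤Ē : E ≤ Ē
  E≤Ē = flipped (trivialColouring G) (trivialColouring-coarsest G d regular) fz fz
  d≤N : d ≤ N
  d≤N = subst (_≤ N) (regular v) (countF≤n N (adj G v))
  nonZero : ∀ {m} → Fin m → NonZero m
  nonZero {suc m} _ = _
  nonDegree : ∀ i → countF N (λ j → not (adj G i j)) ≡ N ∸ d
  nonDegree i = trans (sym (m+n∸m≡n d _))
    (cong (_∸ d) (trans (cong (_+ countF N (λ j → not (adj G i j))) (sym (regular i))) (countF-not N (adj G i))))
  nonDegree-sum : N * (N ∸ d) ≡ Ē + Ē + N
  nonDegree-sum = begin
    N * (N ∸ d)                                        ≡⟨ sumF-const N (N ∸ d) ⟨
    sumF N (λ _ → N ∸ d)                               ≡⟨ sumF-cong N nonDegree ⟨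
    sumF N (λ i → countF N (λ j → not (adj G i j)))    ≡⟨ handshake N (λ i j → not (adj G i j)) (λ i j → cong not (adj-sym G i j)) ⟩
    Ē + Ē + countF N (λ i → not (adj G i i))           ≡⟨ cong (Ē + Ē +_) (countF-true N (λ i → cong not (irrefl G i))) ⟩
    Ē + Ē + N                                          ∎
    where open ≡-Reasoning
  N*[1+d]≤N*[N∸d] : N * suc d ≤ N * (N ∸ d)
  N*[1+d]≤N*[N∸d] = begin
    N * suc d      ≡⟨ *-suc N d ⟩
    N + N * d      ≡⟨ cong (N +_) (degree-sum G d regular) ⟩
    N + (E + E)    ≤⟨ +-monoʳ-≤ N (+-mono-≤ E≤Ē E≤Ē) ⟩
    N + (Ē + Ē)    ≡⟨ +-comm N _ ⟩
    Ē + Ē + N      ≡⟨ nonDegree-sum ⟨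
    N * (N ∸ d)    ∎
    where open ≤-Reasoning

data Parity : ℕ → Set where
  even : ∀ m → Parity (m + m)
  odd  : ∀ m → Parity (suc (m + m))

parity : ∀ n → Parity n
parity zero = even 0
parity (suc n) with parity n
... | even m = odd m
... | odd m  = subst Parity (cong suc (+-suc m m)) (even (suc m))

odd*odd≢even : ∀ p q e → ¬ suc (p + p) * suc (q + q) ≡ e + e
odd*odd≢even p q e eq = even≢odd e (q + p * suc (q + q)) (trans (double e) (trans (sym eq) (odd*odd p q)))
  where
  double : ∀ e → 2 * e ≡ e + e
  double = solve-∀
  odd*odd : ∀ p q → suc (p + p) * suc (q + q) ≡ suc (2 * (q + p * suc (q + q)))
  odd*odd = solve-∀

-- Two-switches

countF-update : ∀ n (f g : Fin n → Bool) p → (∀ y → ¬ y ≡ p → f y ≡ g y) →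
  countF n f + 𝟙 (g p) ≡ countF n g + 𝟙 (f p)
countF-update (suc n) f g fz f≈g = begin
  𝟙 (f fz) + countF n (f ∘ fs) + 𝟙 (g fz)
    ≡⟨ cong (λ c → 𝟙 (f fz) + c + 𝟙 (g fz)) (countF-cong n (λ y → f≈g (fs y) λ ())) ⟩
  𝟙 (f fz) + countF n (g ∘ fs) + 𝟙 (g fz)
    ≡⟨ xy∙z≈zy∙x (𝟙 (f fz)) _ _ ⟩
  𝟙 (g fz) + countF n (g ∘ fs) + 𝟙 (f fz)   ∎
  where open ≡-Reasoning
countF-update (suc n) f g (fs p) f≈g = begin
  𝟙 (f fz) + countF n (f ∘ fs) + 𝟙 (g (fs p))   ≡⟨ +-assoc (𝟙 (f fz)) _ _ ⟩
  𝟙 (f fz) + (countF n (f ∘ fs) + 𝟙 (g (fs p))) ≡⟨ cong₂ _+_ (cong 𝟙 (f≈g fz λ ()))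
                                                      (countF-update n (f ∘ fs) (g ∘ fs) p (λ y y≢p → f≈g (fs y) (y≢p ∘ FP.suc-injective))) ⟩
  𝟙 (g fz) + (countF n (g ∘ fs) + 𝟙 (f (fs p))) ≡⟨ +-assoc (𝟙 (g fz)) _ _ ⟨
  𝟙 (g fz) + countF n (g ∘ fs) + 𝟙 (f (fs p))   ∎
  where open ≡-Reasoning

countF-xor-pair : ∀ n (f : Fin n → Bool) p q → ¬ p ≡ q → f p ≡ true → f q ≡ false →
  countF n (λ y → f y xor ((y ≟ᵇ p) ∨ (y ≟ᵇ q))) ≡ countF n f
countF-xor-pair n f p q p≢q fp fq = +-cancelʳ-≡ 1 (countF n g) (countF n f) (begin
  countF n g + 1         ≡⟨ cong (λ b → countF n g + 𝟙 b) hp ⟨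
  countF n g + 𝟙 (h p)   ≡⟨ countF-update n h g p h≈g ⟨
  countF n h + 𝟙 (g p)   ≡⟨ cong (λ b → countF n h + 𝟙 b) (trans gp (sym fq)) ⟩
  countF n h + 𝟙 (f q)   ≡⟨ countF-update n h f q h≈f ⟩
  countF n f + 𝟙 (h q)   ≡⟨ cong (λ b → countF n f + 𝟙 b) hq ⟩
  countF n f + 1         ∎)
  where
  open ≡-Reasoning
  g h : Fin n → Bool
  g y = f y xor ((y ≟ᵇ p) ∨ (y ≟ᵇ q))
  h y = f y xor (y ≟ᵇ q)
  hq : h q ≡ true
  hq = cong₂ _xor_ fq (≟ᵇ-refl q)
  hp : h p ≡ true
  hp = cong₂ _xor_ fp (≟ᵇ-≢ p≢q)
  gp : g p ≡ false
  gp = cong₂ _xor_ fp (cong (_∨ (p ≟ᵇ q)) (≟ᵇ-refl p))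
  h≈g : ∀ y → ¬ y ≡ p → h y ≡ g y
  h≈g y y≢p = cong (λ b → f y xor (b ∨ (y ≟ᵇ q))) (sym (≟ᵇ-≢ y≢p))
  h≈f : ∀ y → ¬ y ≡ q → h y ≡ f y
  h≈f y y≢q = trans (cong (f y xor_) (≟ᵇ-≢ y≢q)) (xor-identityʳ (f y))

samePair : ∀ {m} (x y u v : Fin m) → Bool
samePair x y u v = ((x ≟ᵇ u) ∧ (y ≟ᵇ v)) ∨ ((x ≟ᵇ v) ∧ (y ≟ᵇ u))

samePair-sym : ∀ {m} (x y u v : Fin m) → samePair x y u v ≡ samePair y x u v
samePair-sym x y u v rewrite ∧-comm (x ≟ᵇ u) (y ≟ᵇ v) | ∧-comm (x ≟ᵇ v) (y ≟ᵇ u) =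
  ∨-comm ((y ≟ᵇ v) ∧ (x ≟ᵇ u)) ((y ≟ᵇ u) ∧ (x ≟ᵇ v))

samePair-∉ : ∀ {m} (x y u v : Fin m) → ¬ x ≡ u → ¬ x ≡ v → samePair x y u v ≡ false
samePair-∉ x y u v x≢u x≢v rewrite ≟ᵇ-≢ x≢u | ≟ᵇ-≢ x≢v = refl

samePair-ˡ : ∀ {m} (y u v : Fin m) → ¬ u ≡ v → samePair u y u v ≡ (y ≟ᵇ v)
samePair-ˡ y u v u≢v rewrite ≟ᵇ-refl u | ≟ᵇ-≢ u≢v = ∨-identityʳ _

samePair-ʳ : ∀ {m} (y u v : Fin m) → ¬ v ≡ u → samePair v y u v ≡ (y ≟ᵇ u)
samePair-ʳ y u v v≢u rewrite ≟ᵇ-refl v | ≟ᵇ-≢ v≢u = refl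

samePair-diag : ∀ {m} (x u v : Fin m) → ¬ u ≡ v → samePair x x u v ≡ false
samePair-diag x u v u≢v = cases (x F.≟ u) (x F.≟ v)
  where
  cases : Dec (x ≡ u) → Dec (x ≡ v) → samePair x x u v ≡ false
  cases (yes refl) _          = trans (samePair-ˡ x x v u≢v) (≟ᵇ-≢ u≢v)
  cases (no x≢u)   (yes refl) = trans (samePair-ʳ x u x x≢u) (≟ᵇ-≢ x≢u)
  cases (no x≢u)   (no x≢v)   = samePair-∉ x x u v x≢u x≢v

module TwoSwitch (G : Graph) (a b c d : Fin (n G))
  (a≢b : ¬ a ≡ b) (a≢c : ¬ a ≡ c) (a≢d : ¬ a ≡ d) (b≢c : ¬ b ≡ c) (b≢d : ¬ b ≡ d) (c≢d : ¬ c ≡ d)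
  (ab : adj G a b ≡ true) (cd : adj G c d ≡ true) (ac : adj G a c ≡ false) (bd : adj G b d ≡ false) where

  toggled : Fin (n G) → Fin (n G) → Bool
  toggled x y = samePair x y a b ∨ (samePair x y c d ∨ (samePair x y a c ∨ samePair x y b d))

  toggled-sym : ∀ x y → toggled x y ≡ toggled y x
  toggled-sym x y rewrite samePair-sym x y a b | samePair-sym x y c d | samePair-sym x y a c | samePair-sym x y b d = refl

  toggled-irrefl : ∀ x → toggled x x ≡ false
  toggled-irrefl x rewrite samePair-diag x a b a≢b | samePair-diag x c d c≢d | samePair-diag x a c a≢c | samePair-diag x b d b≢d = refl

  switched : Graph
  switched = record
    { n = n G
    ; adj = λ x y → adj G x y xor toggled x y
    ; sym = λ x y → cong₂ _xor_ (adj-sym G x y) (toggled-sym x y)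
    ; irrefl = λ x → cong₂ _xor_ (irrefl G x) (toggled-irrefl x)
    }

  toggled-a : ∀ y → toggled a y ≡ (y ≟ᵇ b) ∨ (y ≟ᵇ c)
  toggled-a y rewrite samePair-ˡ y a b a≢b | samePair-∉ a y c d a≢c a≢d | samePair-ˡ y a c a≢c | samePair-∉ a y b d a≢b a≢d =
    cong ((y ≟ᵇ b) ∨_) (∨-identityʳ _)
  toggled-b : ∀ y → toggled b y ≡ (y ≟ᵇ a) ∨ (y ≟ᵇ d)
  toggled-b y rewrite samePair-ʳ y a b (≢-sym a≢b) | samePair-∉ b y c d b≢c b≢d
                    | samePair-∉ b y a c (≢-sym a≢b) b≢c | samePair-ˡ y b d b≢d = refl
  toggled-c : ∀ y → toggled c y ≡ (y ≟ᵇ d) ∨ (y ≟ᵇ a)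
  toggled-c y rewrite samePair-∉ c y a b (≢-sym a≢c) (≢-sym b≢c) | samePair-ˡ y c d c≢d
                    | samePair-ʳ y a c (≢-sym a≢c) | samePair-∉ c y b d (≢-sym b≢c) c≢d =
    cong ((y ≟ᵇ d) ∨_) (∨-identityʳ _)
  toggled-d : ∀ y → toggled d y ≡ (y ≟ᵇ c) ∨ (y ≟ᵇ b)
  toggled-d y rewrite samePair-∉ d y a b (≢-sym a≢d) (≢-sym b≢d) | samePair-ʳ y c d (≢-sym c≢d)
                    | samePair-∉ d y a c (≢-sym a≢d) (≢-sym c≢d) | samePair-ʳ y b d (≢-sym b≢d) = refl
  toggled-∉ : ∀ x y → ¬ x ≡ a → ¬ x ≡ b → ¬ x ≡ c → ¬ x ≡ d → toggled x y ≡ false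
  toggled-∉ x y x≢a x≢b x≢c x≢d rewrite samePair-∉ x y a b x≢a x≢b | samePair-∉ x y c d x≢c x≢d
                                      | samePair-∉ x y a c x≢a x≢c | samePair-∉ x y b d x≢b x≢d = refl

  deg-switched : ∀ x → deg switched x ≡ deg G x
  deg-switched x = cases (x F.≟ a) (x F.≟ b) (x F.≟ c) (x F.≟ d)
    where
    toggle : ∀ y z → (∀ w → toggled x w ≡ (w ≟ᵇ y) ∨ (w ≟ᵇ z)) → ¬ y ≡ z → adj G x y ≡ true → adj G x z ≡ false →
      deg switched x ≡ deg G x
    toggle y z t y≢z xy xz = trans (countF-cong (n G) (λ w → cong (adj G x w xor_) (t w))) (countF-xor-pair (n G) (adj G x) y z y≢z xy xz)
    cases : Dec (x ≡ a) → Dec (x ≡ b) → Dec (x ≡ c) → Dec (x ≡ d) → deg switched x ≡ deg G x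
    cases (yes refl) _ _ _ = toggle b c toggled-a b≢c ab ac
    cases (no _) (yes refl) _ _ = toggle a d toggled-b a≢d (trans (adj-sym G b a) ab) bd
    cases (no _) (no _) (yes refl) _ = toggle d a toggled-c (≢-sym a≢d) cd (trans (adj-sym G c a) ac)
    cases (no _) (no _) (no _) (yes refl) = toggle c b toggled-d (≢-sym b≢c) (trans (adj-sym G d c) cd) (trans (adj-sym G d b) bd)
    cases (no x≢a) (no x≢b) (no x≢c) (no x≢d) =
      countF-cong (n G) (λ y → trans (cong (adj G x y xor_) (toggled-∉ x y x≢a x≢b x≢c x≢d)) (xor-identityʳ _))

  switched-ac : adj switched a c ≡ true
  switched-ac rewrite toggled-a c | ≟ᵇ-refl c | ∨-comm (c ≟ᵇ b) true | ac = refl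

  switched-a : ∀ w → ¬ w ≡ b → ¬ w ≡ c → adj switched a w ≡ adj G a w
  switched-a w w≢b w≢c rewrite toggled-a w | ≟ᵇ-≢ w≢b | ≟ᵇ-≢ w≢c = xor-identityʳ _

  switched-c : ∀ w → ¬ w ≡ d → ¬ w ≡ a → adj switched c w ≡ adj G c w
  switched-c w w≢d w≢a rewrite toggled-c w | ≟ᵇ-≢ w≢d | ≟ᵇ-≢ w≢a = xor-identityʳ _

  private
    adj⇒≢ : ∀ {x w} → adj G x w ≡ true → ¬ w ≡ x
    adj⇒≢ {x} xw refl = true≢false (trans (sym xw) (irrefl G x))

  switched-triangle : ∀ w → adj G a w ≡ true → adj G c w ≡ true → ¬ w ≡ b → ¬ w ≡ d → HasTriangle switched
  switched-triangle w aw cw w≢b w≢d =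
    a , c , w , switched-ac , trans (switched-c w w≢d (adj⇒≢ aw)) cw , trans (switched-a w w≢b (adj⇒≢ cw)) aw

  -- b was the only common neighbour of a and c, and the switch removes ab.
  switched-lonely : (∀ w → adj G a w ≡ true → adj G c w ≡ true → w ≡ b) → HasEdgeOutsideTriangles switched
  switched-lonely onlyB = a , c , switched-ac , noCommon
    where
    noCommon : ∀ w → adj switched a w ≡ true → adj switched c w ≡ true → ⊥
    noCommon w aw cw = cases (w F.≟ c) (w F.≟ a) (w F.≟ b) (w F.≟ d)
      where
      cases : Dec (w ≡ c) → Dec (w ≡ a) → Dec (w ≡ b) → Dec (w ≡ d) → ⊥
      cases (yes refl) _ _ _ = true≢false (trans (sym cw) (irrefl switched c))
      cases (no _) (yes refl) _ _ = true≢false (trans (sym aw) (irrefl switched a))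
      cases (no _) (no _) (yes refl) _ =
        true≢false (trans (sym aw) (cong₂ _xor_ ab (trans (toggled-a b) (cong (_∨ (b ≟ᵇ c)) (≟ᵇ-refl b)))))
      cases (no _) (no _) (no _) (yes refl) =
        true≢false (trans (sym cw) (cong₂ _xor_ cd (trans (toggled-c d) (cong (_∨ (d ≟ᵇ a)) (≟ᵇ-refl d)))))
      cases (no w≢c) (no w≢a) (no w≢b) (no w≢d) =
        w≢b (onlyB w (trans (sym (switched-a w w≢b w≢c)) aw) (trans (sym (switched-c w w≢d w≢a)) cw))

-- Circulant graphs

-- Arithmetic in ℤ/Nℤ on representatives 0 … N-1; dist x y is the step from x forward to y.
module Cyclic (n' : ℕ) where

  N : ℕ
  N = suc n'

  %-+ˡ : ∀ a b → ((a % N) + b) % N ≡ (a + b) % N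
  %-+ˡ a b = begin
    ((a % N) + b) % N            ≡⟨ %-distribˡ-+ (a % N) b N ⟩
    ((a % N % N) + (b % N)) % N  ≡⟨ cong (λ z → (z + (b % N)) % N) (m%n%n≡m%n a N) ⟩
    ((a % N) + (b % N)) % N      ≡⟨ %-distribˡ-+ a b N ⟨
    (a + b) % N                  ∎
    where open ≡-Reasoning

  %-+ʳ : ∀ a b → (a + (b % N)) % N ≡ (a + b) % N
  %-+ʳ a b = trans (cong (_% N) (+-comm a _)) (trans (%-+ˡ b a) (cong (_% N) (+-comm b a)))

  +N%N : ∀ a → a < N → (a + N) % N ≡ a
  +N%N a a<N = trans ([m+n]%n≡m%n a N) (m<n⇒m%n≡m a<N)

  %-cases : ∀ a b → a < N + N → a % N ≡ b → (a ≡ b) ⊎ (a ≡ b + N)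
  %-cases a b a<2N a%N≡b with a <? N
  ... | yes a<N = inj₁ (trans (sym (m<n⇒m%n≡m a<N)) a%N≡b)
  ... | no a≮N = inj₂ (trans (sym (m∸n+n≡m N≤a)) (cong (_+ N) (begin
    a ∸ N            ≡⟨ m<n⇒m%n≡m a∸N<N ⟨
    (a ∸ N) % N      ≡⟨ [m+n]%n≡m%n (a ∸ N) N ⟨
    (a ∸ N + N) % N  ≡⟨ cong (_% N) (m∸n+n≡m N≤a) ⟩
    a % N            ≡⟨ a%N≡b ⟩
    b                ∎)))
    where
    open ≡-Reasoning
    N≤a : N ≤ a
    N≤a = ≮⇒≥ a≮N
    a∸N<N : a ∸ N < N
    a∸N<N = +-cancelʳ-< N (a ∸ N) N (subst (_< N + N) (sym (m∸n+n≡m N≤a)) a<2N)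

  1+%N≡ : ∀ e s → e < N → (1 + e) % N ≡ s → 1 ≤ s → 1 + e ≡ s
  1+%N≡ e s e<N e≡s 1≤s with m≤n⇒m<n∨m≡n e<N
  ... | inj₁ 1+e<N = trans (sym (m<n⇒m%n≡m 1+e<N)) e≡s
  ... | inj₂ 1+e≡N = ⊥-elim (<⇒≱ 1≤s (≤-reflexive (trans (sym e≡s) (trans (cong (_% N) 1+e≡N) (n%n≡0 N)))))

  1+%N≡0 : ∀ e → e < N → (1 + e) % N ≡ 0 → 1 + e ≡ N
  1+%N≡0 e e<N e≡0 with m≤n⇒m<n∨m≡n e<N
  ... | inj₁ 1+e<N = ⊥-elim (1+n≢0 (trans (sym (m<n⇒m%n≡m 1+e<N)) e≡0))
  ... | inj₂ 1+e≡N = 1+e≡N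

  dist : ℕ → ℕ → ℕ
  dist x y = (y + (N ∸ x)) % N

  shift : ℕ → ℕ → ℕ
  shift x t = (x + t) % N

  dist<N : ∀ x y → dist x y < N
  dist<N x y = m%n<n (y + (N ∸ x)) N

  dist-shift : ∀ x t → x < N → t < N → dist x (shift x t) ≡ t
  dist-shift x t x<N t<N = begin
    ((x + t) % N + (N ∸ x)) % N  ≡⟨ %-+ˡ (x + t) (N ∸ x) ⟩
    (x + t + (N ∸ x)) % N        ≡⟨ cong (_% N) (trans (rearrange x t (N ∸ x)) (cong (t +_) (m+[n∸m]≡n (<⇒≤ x<N)))) ⟩
    (t + N) % N                  ≡⟨ +N%N t t<N ⟩
    t                            ∎
    where
    open ≡-Reasoning
    rearrange : ∀ a b c → a + b + c ≡ b + (a + c)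
    rearrange = solve-∀

  shift-dist : ∀ x y → x < N → y < N → shift x (dist x y) ≡ y
  shift-dist x y x<N y<N = begin
    (x + (y + (N ∸ x)) % N) % N  ≡⟨ %-+ʳ x (y + (N ∸ x)) ⟩
    (x + (y + (N ∸ x))) % N      ≡⟨ cong (_% N) (trans (rearrange x y (N ∸ x)) (cong (y +_) (m+[n∸m]≡n (<⇒≤ x<N)))) ⟩
    (y + N) % N                  ≡⟨ +N%N y y<N ⟩
    y                            ∎
    where
    open ≡-Reasoning
    rearrange : ∀ a b c → a + (b + c) ≡ b + (a + c)
    rearrange = solve-∀

  shift≡⇒dist≡ : ∀ x t y → x < N → t < N → shift x t ≡ y → dist x y ≡ t
  shift≡⇒dist≡ x t y x<N t<N refl = dist-shift x t x<N t<N

  dist-+ : ∀ x t y → y < N → x + t ≡ y → dist x y ≡ t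
  dist-+ x t y y<N x+t≡y = shift≡⇒dist≡ x t y
    (≤-<-trans (m≤m+n x t) (subst (_< N) (sym x+t≡y) y<N))
    (≤-<-trans (m≤n+m t x) (subst (_< N) (sym x+t≡y) y<N))
    (trans (cong (_% N) x+t≡y) (m<n⇒m%n≡m y<N))

  dist-+N : ∀ x t y → x < N → y < N → t < N → x + t ≡ y + N → dist x y ≡ t
  dist-+N x t y x<N y<N t<N x+t≡y+N = shift≡⇒dist≡ x t y x<N t<N (trans (cong (_% N) x+t≡y+N) (+N%N y y<N))

  dist-self : ∀ x → x < N → dist x x ≡ 0
  dist-self x x<N = dist-+ x 0 x x<N (+-identityʳ x)

  dist-trans : ∀ x y z → y < N → dist x z ≡ (dist x y + dist y z) % N
  dist-trans x y z y<N = sym (begin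
    ((y + (N ∸ x)) % N + (z + (N ∸ y)) % N) % N  ≡⟨ %-+ˡ (y + (N ∸ x)) _ ⟩
    ((y + (N ∸ x)) + (z + (N ∸ y)) % N) % N      ≡⟨ %-+ʳ (y + (N ∸ x)) _ ⟩
    ((y + (N ∸ x)) + (z + (N ∸ y))) % N
      ≡⟨ cong (_% N) (trans (rearrange y (N ∸ x) z (N ∸ y)) (cong ((z + (N ∸ x)) +_) (m+[n∸m]≡n (<⇒≤ y<N)))) ⟩
    ((z + (N ∸ x)) + N) % N                      ≡⟨ [m+n]%n≡m%n (z + (N ∸ x)) N ⟩
    (z + (N ∸ x)) % N                            ∎)
    where
    open ≡-Reasoning
    rearrange : ∀ a b c e → (a + b) + (c + e) ≡ (c + b) + (a + e)
    rearrange = solve-∀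

  dist-involutive : ∀ x y → x < N → y < N → dist (dist y x) x ≡ y
  dist-involutive x y x<N y<N = shift≡⇒dist≡ (dist y x) y x (dist<N y x) y<N (begin
    ((x + (N ∸ y)) % N + y) % N  ≡⟨ %-+ˡ (x + (N ∸ y)) y ⟩
    (x + (N ∸ y) + y) % N        ≡⟨ cong (_% N) (trans (rearrange x (N ∸ y) y) (cong (x +_) (m+[n∸m]≡n (<⇒≤ y<N)))) ⟩
    (x + N) % N                  ≡⟨ +N%N x x<N ⟩
    x                            ∎)
    where
    open ≡-Reasoning
    rearrange : ∀ a b c → a + b + c ≡ a + (c + b)
    rearrange = solve-∀

  distF : Fin N → Fin N → Fin N
  distF x y = fromℕ< (dist<N (toℕ x) (toℕ y))

  shiftF : Fin N → ℕ → Fin N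
  shiftF x t = fromℕ< (m%n<n (toℕ x + t) N)

  toℕ-distF : ∀ x y → toℕ (distF x y) ≡ dist (toℕ x) (toℕ y)
  toℕ-distF x y = FP.toℕ-fromℕ< _

  toℕ-shiftF : ∀ x t → toℕ (shiftF x t) ≡ shift (toℕ x) t
  toℕ-shiftF x t = FP.toℕ-fromℕ< _

  shiftPerm : Fin N → Permutation N N
  shiftPerm x = permutation (distF x) (λ t → shiftF x (toℕ t))
    (λ t → FP.toℕ-injective (trans (toℕ-distF x (shiftF x (toℕ t))) (trans (cong (dist (toℕ x)) (toℕ-shiftF x (toℕ t)))
             (dist-shift (toℕ x) (toℕ t) (FP.toℕ<n x) (FP.toℕ<n t)))))
    (λ y → FP.toℕ-injective (trans (toℕ-shiftF x (toℕ (distF x y))) (trans (cong (shift (toℕ x)) (toℕ-distF x y))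
             (shift-dist (toℕ x) (toℕ y) (FP.toℕ<n x) (FP.toℕ<n y)))))

  reflectPerm : Fin N → Permutation N N
  reflectPerm x = permutation (λ y → distF y x) (λ y → distF y x) involutive involutive
    where
    involutive : ∀ y → distF (distF y x) x ≡ y
    involutive y = FP.toℕ-injective (trans (toℕ-distF (distF y x) x)
      (trans (cong (λ z → dist z (toℕ x)) (toℕ-distF y x)) (dist-involutive (toℕ x) (toℕ y) (FP.toℕ<n x) (FP.toℕ<n y))))

  countF-dist-from : ∀ (P : ℕ → Bool) x → countF N (λ y → P (dist (toℕ x) (toℕ y))) ≡ countF N (P ∘ toℕ)
  countF-dist-from P x = trans (countF-cong N (λ y → cong P (sym (toℕ-distF x y)))) (countF-perm N N (shiftPerm x) (P ∘ toℕ))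

  countF-dist-to : ∀ (P : ℕ → Bool) x → countF N (λ y → P (dist (toℕ y) (toℕ x))) ≡ countF N (P ∘ toℕ)
  countF-dist-to P x = trans (countF-cong N (λ y → cong P (sym (toℕ-distF y x)))) (countF-perm N N (reflectPerm x) (P ∘ toℕ))

  countF-shift : ∀ (P : ℕ → Bool) x → x < N → countF N (λ y → P (shift x (toℕ y))) ≡ countF N (P ∘ toℕ)
  countF-shift P x x<N = trans (countF-cong N (λ y → cong P (trans (cong (λ z → shift z (toℕ y)) (sym (FP.toℕ-fromℕ< x<N)))
                                                                   (sym (toℕ-shiftF (fromℕ< x<N) (toℕ y))))))
                               (countF-perm N N (flip (shiftPerm (fromℕ< x<N))) (P ∘ toℕ))

inRange : ℕ → ℕ → Bool
inRange k t = (1 ≤ᵇ t) ∧ (t ≤ᵇ k)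

inRange⇒ : ∀ k t → inRange k t ≡ true → (1 ≤ t) × (t ≤ k)
inRange⇒ k (suc t) e = s≤s z≤n , ≤ᵇ≡true⇒≤ (suc t) k e

inRange-true : ∀ k t → 1 ≤ t → t ≤ k → inRange k t ≡ true
inRange-true k (suc t) _ t≤k = ≤ᵇ-true t≤k

inRange-false : ∀ k t → k < t → inRange k t ≡ false
inRange-false k zero    _   = refl
inRange-false k (suc t) k<t = ≤ᵇ-false k<t

-- The circulant graph on ℤ/N with connection set {±1, …, ±k}.
module CirculantGraph (n' k : ℕ) where
  open Cyclic n' public

  circAdj : Fin N → Fin N → Bool
  circAdj x y = inRange k (dist (toℕ x) (toℕ y)) ∨ inRange k (dist (toℕ y) (toℕ x))

  circulant : Graph
  circulant = record
    { n = N
    ; adj = circAdj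
    ; sym = λ x y → ∨-comm (inRange k (dist (toℕ x) (toℕ y))) _
    ; irrefl = λ x → cong (λ t → inRange k t ∨ inRange k t) (dist-self (toℕ x) (FP.toℕ<n x))
    }

  circAdj-fwd : ∀ x y → inRange k (dist (toℕ x) (toℕ y)) ≡ true → circAdj x y ≡ true
  circAdj-fwd x y e = cong (_∨ inRange k (dist (toℕ y) (toℕ x))) e

  circAdj-bwd : ∀ x y → inRange k (dist (toℕ y) (toℕ x)) ≡ true → circAdj x y ≡ true
  circAdj-bwd x y e = trans (cong (inRange k (dist (toℕ x) (toℕ y)) ∨_) e) (∨-zeroʳ _)

  -- With 2k < N a forward and a backward step of length ≤ k cannot coincide.
  deg-circulant : k + k ≤ n' → ∀ x → deg circulant x ≡ k + k
  deg-circulant 2k≤n' x = begin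
    countF N (circAdj x)
      ≡⟨ countF-+ N (circAdj x) (λ y → inRange k (dist X (toℕ y))) (λ y → inRange k (dist (toℕ y) X))
                  (λ y → disjoint y (inRange k (dist X (toℕ y))) (inRange k (dist (toℕ y) X)) refl refl) ⟩
    countF N (λ y → inRange k (dist X (toℕ y))) + countF N (λ y → inRange k (dist (toℕ y) X))
      ≡⟨ cong₂ _+_ (countF-dist-from (inRange k) x) (countF-dist-to (inRange k) x) ⟩
    countF N (λ t → inRange k (toℕ t)) + countF N (λ t → inRange k (toℕ t))
      ≡⟨ cong₂ _+_ count-range count-range ⟩
    k + k ∎
    where
    open ≡-Reasoning
    X = toℕ x
    -- inRange k 0 is false and inRange k (1 + t) reduces to t <ᵇ k.
    count-range : countF N (λ t → inRange k (toℕ t)) ≡ k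
    count-range = countF-<ᵇ n' k (≤-trans (m≤m+n k k) 2k≤n')
    disjoint : ∀ y p q → inRange k (dist X (toℕ y)) ≡ p → inRange k (dist (toℕ y) X) ≡ q → 𝟙 (p ∨ q) ≡ 𝟙 p + 𝟙 q
    disjoint y true  true  e₁ e₂ = ⊥-elim (<⇒≱ (proj₁ r₁) (≤-reflexive (m+n≡0⇒m≡0 _ sum≡0)))
      where
      r₁ = inRange⇒ k (dist X (toℕ y)) e₁
      r₂ = inRange⇒ k (dist (toℕ y) X) e₂
      sum<N : dist X (toℕ y) + dist (toℕ y) X < N
      sum<N = s≤s (≤-trans (+-mono-≤ (proj₂ r₁) (proj₂ r₂)) 2k≤n')
      sum≡0 : dist X (toℕ y) + dist (toℕ y) X ≡ 0
      sum≡0 = trans (sym (m<n⇒m%n≡m sum<N)) (trans (sym (dist-trans X (toℕ y) X (FP.toℕ<n y))) (dist-self X (FP.toℕ<n x)))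
    disjoint y true  false _ _ = refl
    disjoint y false q     _ _ = refl

  -- An edge x → x+s (1 ≤ s ≤ k) lies in the triangle with x+2 if s = 1, and with x+1 otherwise.
  module _ (2≤k : 2 ≤ k) (2k≤n' : k + k ≤ n') where
    private
      1≤k : 1 ≤ k
      1≤k = ≤-trans (s≤s z≤n) 2≤k
      2<N : 2 < N
      2<N = s≤s (≤-trans 2≤k (≤-trans (m≤m+n k k) 2k≤n'))

    forward-inTriangle : ∀ i j → inRange k (dist (toℕ i) (toℕ j)) ≡ true →
      ∃ λ w → (circAdj i w ≡ true) × (circAdj j w ≡ true)
    forward-inTriangle i j e with inRange⇒ k (dist (toℕ i) (toℕ j)) e
    ... | 1≤s , s≤k with m≤n⇒m<n∨m≡n 1≤s
    ...   | inj₂ 1≡s = w , circAdj-fwd i w (trans (cong (inRange k) i→w) (inRange-true k 2 (s≤s z≤n) 2≤k))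
                         , circAdj-fwd j w (trans (cong (inRange k) j→w) (inRange-true k 1 ≤-refl 1≤k))
      where
      w = shiftF i 2
      i→w : dist (toℕ i) (toℕ w) ≡ 2
      i→w = trans (cong (dist (toℕ i)) (toℕ-shiftF i 2)) (dist-shift (toℕ i) 2 (FP.toℕ<n i) 2<N)
      j→w : dist (toℕ j) (toℕ w) ≡ 1
      j→w = suc-injective (1+%N≡ (dist (toℕ j) (toℕ w)) 2 (dist<N (toℕ j) (toℕ w))
        (trans (cong (λ z → (z + dist (toℕ j) (toℕ w)) % N) 1≡s)
               (trans (sym (dist-trans (toℕ i) (toℕ j) (toℕ w) (FP.toℕ<n j))) i→w)) (s≤s z≤n))
    ...   | inj₁ 1<s = w , circAdj-fwd i w (trans (cong (inRange k) i→w) (inRange-true k 1 ≤-refl 1≤k))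
                         , circAdj-bwd j w (trans (cong (inRange k) w→j)
                                                  (inRange-true k (pred s) (pred-mono-≤ 1<s) (≤-trans pred[n]≤n s≤k)))
      where
      s = dist (toℕ i) (toℕ j)
      w = shiftF i 1
      i→w : dist (toℕ i) (toℕ w) ≡ 1
      i→w = trans (cong (dist (toℕ i)) (toℕ-shiftF i 1)) (dist-shift (toℕ i) 1 (FP.toℕ<n i) (≤-trans (s≤s (s≤s z≤n)) 2<N))
      w→j : dist (toℕ w) (toℕ j) ≡ pred s
      w→j = cong pred (1+%N≡ (dist (toℕ w) (toℕ j)) s (dist<N (toℕ w) (toℕ j))
        (trans (cong (λ z → (z + dist (toℕ w) (toℕ j)) % N) (sym i→w))
               (sym (dist-trans (toℕ i) (toℕ w) (toℕ j) (FP.toℕ<n w)))) 1≤s)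

    edgesInTriangles : EdgesInTriangles circulant
    edgesInTriangles i j ij with ∨≡true {inRange k (dist (toℕ i) (toℕ j))} ij
    ... | inj₁ fwd = forward-inTriangle i j fwd
    ... | inj₂ bwd with forward-inTriangle j i bwd
    ...   | w , jw , iw = w , iw , jw

  circAdj-interval : ∀ x y → k ≤ toℕ x → toℕ x + k < N → circAdj x y ≡ true →
    (toℕ x ≤ toℕ y + k) × (toℕ y ≤ toℕ x + k)
  circAdj-interval x y k≤X X+k<N xy with ∨≡true {inRange k (dist (toℕ x) (toℕ y))} xy
  ... | inj₁ e = ≤-trans (≤-trans (m≤m+n X u) (≤-reflexive X+u≡Y)) (m≤m+n Y k)
               , subst (_≤ X + k) X+u≡Y (+-monoʳ-≤ X u≤k)
    where
    X = toℕ x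
    Y = toℕ y
    u = dist X Y
    u≤k = proj₂ (inRange⇒ k u e)
    X+u≡Y : X + u ≡ Y
    X+u≡Y = trans (sym (m<n⇒m%n≡m (≤-<-trans (+-monoʳ-≤ X u≤k) X+k<N))) (shift-dist X Y (FP.toℕ<n x) (FP.toℕ<n y))
  ... | inj₂ e with %-cases (toℕ y + dist (toℕ y) (toℕ x)) (toℕ x)
                     (+-mono-<-≤ (FP.toℕ<n y) (<⇒≤ (≤-<-trans (proj₂ (inRange⇒ k _ e)) (≤-<-trans (m≤n+m k (toℕ x)) X+k<N))))
                     (shift-dist (toℕ y) (toℕ x) (FP.toℕ<n y) (FP.toℕ<n x))
  ...   | inj₁ Y+u≡X = subst (_≤ toℕ y + k) Y+u≡X (+-monoʳ-≤ (toℕ y) (proj₂ (inRange⇒ k _ e)))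
                     , ≤-trans (≤-trans (m≤m+n (toℕ y) _) (≤-reflexive Y+u≡X)) (m≤m+n (toℕ x) k)
  ...   | inj₂ Y+u≡X+N = ⊥-elim (<⇒≱ X<k k≤X)
    where
    X<k : toℕ x < k
    X<k = +-cancelʳ-< N (toℕ x) k (subst (_< k + N) Y+u≡X+N
            (subst (toℕ y + dist (toℕ y) (toℕ x) <_) (+-comm N k)
              (+-mono-<-≤ (FP.toℕ<n y) (proj₂ (inRange⇒ k _ e)))))

-- The cycle C_(4+r).
module CycleGraph (r : ℕ) where
  open CirculantGraph (3 + r) 1 public

  Step : ℕ → Set
  Step t = (t ≡ 1) ⊎ (t ≡ 3 + r)

  step : ∀ x y → circAdj x y ≡ true → Step (dist (toℕ x) (toℕ y))
  step x y xy with ∨≡true {inRange 1 (dist (toℕ x) (toℕ y))} xy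
  ... | inj₁ e = inj₁ (≤-antisym (proj₂ (inRange⇒ 1 _ e)) (proj₁ (inRange⇒ 1 _ e)))
  ... | inj₂ e = inj₂ (suc-injective (1+%N≡0 (dist X Y) (dist<N X Y) (begin
      (1 + dist X Y) % N          ≡⟨ cong (_% N) (+-comm 1 (dist X Y)) ⟩
      (dist X Y + 1) % N          ≡⟨ cong (λ z → (dist X Y + z) % N) Y→X ⟨
      (dist X Y + dist Y X) % N   ≡⟨ dist-trans X Y X (FP.toℕ<n y) ⟨
      dist X X                    ≡⟨ dist-self X (FP.toℕ<n x) ⟩
      0                           ∎)))
    where
    open ≡-Reasoning
    X = toℕ x
    Y = toℕ y
    Y→X : dist Y X ≡ 1
    Y→X = ≤-antisym (proj₂ (inRange⇒ 1 _ e)) (proj₁ (inRange⇒ 1 _ e))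

  -- Two steps of ±1 never make a step of ±1 in ℤ/N when N ≥ 4.
  two-steps : ∀ p q → Step p → Step q → Step ((p + q) % N) → ⊥
  two-steps _ _ (inj₁ refl) (inj₁ refl) (inj₁ ())
  two-steps _ _ (inj₁ refl) (inj₁ refl) (inj₂ ())
  two-steps _ _ (inj₁ refl) (inj₂ refl) s = zero-not-step (subst Step (n%n≡0 N) s)
    where
    zero-not-step : Step 0 → ⊥
    zero-not-step (inj₁ ())
    zero-not-step (inj₂ ())
  two-steps _ _ (inj₂ refl) (inj₁ refl) s = two-steps 1 (3 + r) (inj₁ refl) (inj₂ refl) (subst Step (cong (_% N) (+-comm (3 + r) 1)) s)
  two-steps _ _ (inj₂ refl) (inj₂ refl) s with subst Step (trans (cong (_% N) (wrap r)) (+N%N (2 + r) 2+r<N)) s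
    where
    wrap : ∀ r → (3 + r) + (3 + r) ≡ (2 + r) + (4 + r)
    wrap = solve-∀
    2+r<N : 2 + r < N
    2+r<N = <-trans (n<1+n (2 + r)) (n<1+n (3 + r))
  ... | inj₁ 2+r≡1 = 1+n≢0 (suc-injective 2+r≡1)
  ... | inj₂ 2+r≡3+r = <-irrefl 2+r≡3+r (n<1+n (2 + r))

  triangleFree : TriangleFree circulant
  triangleFree (a , b , c , ab , bc , ac) =
    two-steps _ _ (step a b ab) (step b c bc) (subst Step (dist-trans (toℕ a) (toℕ b) (toℕ c) (FP.toℕ<n b)) (step a c ac))

-- Pairs of non-isomorphic regular graphs

-- Switching {1,0}, {3,4} to {1,3}, {0,4} in the cycle C_N closes the triangle 1, 2, 3.
module CycleSwitch (r : ℕ) where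
  open CycleGraph (2 + r)
  2≤5+r : 1 + 1 ≤ 5 + r
  2≤5+r = s≤s (s≤s z≤n)
  <N : ∀ {a} → a ≤ 5 → a < N
  <N a≤5 = s≤s (≤-trans a≤5 (m≤m+n 5 r))
  1~0 : circAdj (# 1) (# 0) ≡ true
  1~0 = circAdj-bwd (# 1) (# 0) (cong (inRange 1) (dist-+ 0 1 1 (<N (s≤s z≤n)) refl))
  3~4 : circAdj (# 3) (# 4) ≡ true
  3~4 = circAdj-fwd (# 3) (# 4) (cong (inRange 1) (dist-+ 3 1 4 (<N (s≤s (s≤s (s≤s (s≤s z≤n))))) refl))
  1≁3 : circAdj (# 1) (# 3) ≡ false
  1≁3 rewrite dist-+ 1 2 3 (<N (s≤s (s≤s (s≤s z≤n)))) refl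
            | dist-+N 3 (4 + r) 1 (<N (s≤s (s≤s (s≤s z≤n)))) (<N (s≤s z≤n)) (s≤s (n≤1+n (4 + r))) refl = refl
  0≁4 : circAdj (# 0) (# 4) ≡ false
  0≁4 rewrite dist-+ 0 4 4 (<N (s≤s (s≤s (s≤s (s≤s z≤n))))) refl
            | dist-+N 4 (2 + r) 0 (<N (s≤s (s≤s (s≤s (s≤s z≤n))))) (<N z≤n)
                      (+-monoˡ-< r {2} {6} (s≤s (s≤s (s≤s z≤n)))) refl = refl
  1~2 : circAdj (# 1) (# 2) ≡ true
  1~2 = circAdj-fwd (# 1) (# 2) (cong (inRange 1) (dist-+ 1 1 2 (<N (s≤s (s≤s z≤n))) refl))
  3~2 : circAdj (# 3) (# 2) ≡ true
  3~2 = circAdj-bwd (# 3) (# 2) (cong (inRange 1) (dist-+ 2 1 3 (<N (s≤s (s≤s (s≤s z≤n)))) refl))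
  open TwoSwitch circulant (# 1) (# 0) (# 3) (# 4) (λ ()) (λ ()) (λ ()) (λ ()) (λ ()) (λ ()) 1~0 3~4 1≁3 0≁4

  pair : NonIsomorphicRegular (6 + r) 2
  pair = record
    { G₁ = switched ; G₂ = circulant ; size₁ = refl ; size₂ = refl
    ; regular₁ = λ v → trans (deg-switched v) (deg-circulant 2≤5+r v)
    ; regular₂ = deg-circulant 2≤5+r
    ; G₁≇G₂ = triangle-≇ switched circulant (switched-triangle (# 2) 1~2 3~2 (λ ()) (λ ())) triangleFree
    }

cycle-family : ∀ N → 6 ≤ N → NonIsomorphicRegular N 2
cycle-family _ 6≤N with m≤n⇒∃[o]m+o≡n 6≤N
... | r , refl = CycleSwitch.pair r

-- For k ≥ 2 and N ≥ 4k + 1 the circulant C_N(1, …, k) has every edge in a triangle; switching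
-- {3k, 2k}, {k, 0} to {3k, k}, {2k, 0} creates an edge {3k, k} whose only common neighbour was 2k.
module CirculantSwitch (k r : ℕ) (2≤k : 2 ≤ k) where
  open CirculantGraph (k + k + k + k + r) k
  4k<N : k + k + k + k < N
  4k<N = s≤s (m≤m+n _ r)
  1≤k : 1 ≤ k
  1≤k = ≤-trans (s≤s z≤n) 2≤k
  2k≤n' : k + k ≤ k + k + k + k + r
  2k≤n' = ≤-trans (m≤m+n (k + k) (k + k)) (≤-trans (≤-reflexive (sym (+-assoc (k + k) k k))) (m≤m+n _ r))
  3k<N : k + k + k < N
  3k<N = ≤-<-trans (m≤m+n _ k) 4k<N
  2k<N : k + k < N
  2k<N = ≤-<-trans (m≤m+n _ k) 3k<N
  k<N : k < N
  k<N = ≤-<-trans (m≤m+n _ k) 2k<N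
  a b c d : Fin N
  a = fromℕ< 3k<N
  b = fromℕ< 2k<N
  c = fromℕ< k<N
  d = fz
  a≡3k : toℕ a ≡ k + k + k
  a≡3k = FP.toℕ-fromℕ< 3k<N
  b≡2k : toℕ b ≡ k + k
  b≡2k = FP.toℕ-fromℕ< 2k<N
  c≡k : toℕ c ≡ k
  c≡k = FP.toℕ-fromℕ< k<N
  k<2k : k < k + k
  k<2k = m<m+n k 1≤k
  far : inRange k (suc (k + k + r)) ≡ false
  far = inRange-false k _ (s≤s (≤-trans (m≤m+n k k) (m≤m+n _ r)))
  3k-2k : circAdj a b ≡ true
  3k-2k = circAdj-bwd a b (trans (cong₂ (λ x y → inRange k (dist x y)) b≡2k a≡3k)
                                  (trans (cong (inRange k) (dist-+ (k + k) k _ 3k<N refl)) (inRange-true k k 1≤k ≤-refl)))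
  k-0 : circAdj c d ≡ true
  k-0 = circAdj-bwd c d (trans (cong (λ y → inRange k (dist 0 y)) c≡k)
                               (trans (cong (inRange k) (dist-+ 0 k k k<N refl)) (inRange-true k k 1≤k ≤-refl)))
  far<N : suc (k + k + r) < N
  far<N = s≤s (+-monoˡ-≤ r (≤-trans (m<m+n (k + k) 1≤k) (m≤m+n (k + k + k) k)))
  wrap₁ : ∀ k r → k + k + k + suc (k + k + r) ≡ k + suc (k + k + k + k + r)
  wrap₁ = solve-∀
  wrap₂ : ∀ k r → k + k + suc (k + k + r) ≡ 0 + suc (k + k + k + k + r)
  wrap₂ = solve-∀
  3k≁k : circAdj a c ≡ false
  3k≁k rewrite a≡3k | c≡k
    | dist-+N (k + k + k) (suc (k + k + r)) k 3k<N k<N far<N (wrap₁ k r)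
    | dist-+ k (k + k) (k + k + k) 3k<N (sym (+-assoc k k k)) | inRange-false k (k + k) k<2k | far = refl
  2k≁0 : circAdj b d ≡ false
  2k≁0 rewrite b≡2k
    | dist-+N (k + k) (suc (k + k + r)) 0 2k<N (s≤s z≤n) far<N (wrap₂ k r)
    | dist-+ 0 (k + k) (k + k) 2k<N refl | inRange-false k (k + k) k<2k | far = refl
  ≢-toℕ : ∀ {x y : Fin N} → ¬ toℕ x ≡ toℕ y → ¬ x ≡ y
  ≢-toℕ toℕ≢ refl = toℕ≢ refl
  m+n≢m : ∀ m n → 1 ≤ n → ¬ m + n ≡ m
  m+n≢m m n 1≤n e = <⇒≱ 1≤n (≤-reflexive (+-cancelˡ-≡ m n 0 (trans e (sym (+-identityʳ m)))))
  a≢b : ¬ a ≡ b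
  a≢b = ≢-toℕ λ e → m+n≢m (k + k) k 1≤k (trans (sym a≡3k) (trans e b≡2k))
  a≢c : ¬ a ≡ c
  a≢c = ≢-toℕ λ e → m+n≢m k (k + k) (≤-trans 1≤k (m≤m+n k k)) (trans (sym (+-assoc k k k)) (trans (sym a≡3k) (trans e c≡k)))
  a≢d : ¬ a ≡ d
  a≢d = ≢-toℕ λ e → <⇒≱ 1≤k (≤-reflexive (m+n≡0⇒n≡0 (k + k) (trans (sym a≡3k) e)))
  b≢c : ¬ b ≡ c
  b≢c = ≢-toℕ λ e → m+n≢m k k 1≤k (trans (sym b≡2k) (trans e c≡k))
  b≢d : ¬ b ≡ d
  b≢d = ≢-toℕ λ e → <⇒≱ 1≤k (≤-reflexive (m+n≡0⇒n≡0 k (trans (sym b≡2k) e)))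
  c≢d : ¬ c ≡ d
  c≢d = ≢-toℕ λ e → <⇒≱ 1≤k (≤-reflexive (trans (sym c≡k) e))
  -- A common neighbour of 3k and k lies in [2k, 4k] ∩ [0, 2k].
  onlyB : ∀ w → circAdj a w ≡ true → circAdj c w ≡ true → w ≡ b
  onlyB w aw cw = FP.toℕ-injective (trans (≤-antisym W≤2k 2k≤W) (sym b≡2k))
    where
    W = toℕ w
    near-a = circAdj-interval a w (subst (k ≤_) (sym a≡3k) (m≤n+m k (k + k)))
                               (subst (λ x → x + k < N) (sym a≡3k) 4k<N) aw
    near-c = circAdj-interval c w (≤-reflexive (sym c≡k)) (subst (λ x → x + k < N) (sym c≡k) (≤-<-trans (m≤m+n _ k) 3k<N)) cw
    W≤2k : W ≤ k + k
    W≤2k = subst (λ x → W ≤ x + k) c≡k (proj₂ near-c)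
    2k≤W : k + k ≤ W
    2k≤W = +-cancelʳ-≤ k (k + k) W (subst (_≤ W + k) a≡3k (proj₁ near-a))
  open TwoSwitch circulant a b c d a≢b a≢c a≢d b≢c b≢d c≢d 3k-2k k-0 3k≁k 2k≁0

  pair : NonIsomorphicRegular (suc (k + k + k + k + r)) (k + k)
  pair = record
    { G₁ = circulant ; G₂ = switched ; size₁ = refl ; size₂ = refl
    ; regular₁ = deg-circulant 2k≤n'
    ; regular₂ = λ v → trans (deg-switched v) (deg-circulant 2k≤n' v)
    ; G₁≇G₂ = edgesInTriangles-≇ circulant switched (edgesInTriangles 2≤k 2k≤n') (switched-lonely onlyB)
    }

circulant-family : ∀ k N → 2 ≤ k → suc (k + k + k + k) ≤ N → NonIsomorphicRegular N (k + k)
circulant-family k _ 2≤k 4k<N with m≤n⇒∃[o]m+o≡n 4k<N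
... | r , refl = CirculantSwitch.pair k r 2≤k

-- With m = 3 + m'': sides {0, …, m-1} and {m, …, 2m-1}; left X is joined to right m + R when (X + R) mod m < d.
module BipartiteCirculant (m'' d : ℕ) where
  open Cyclic (suc (suc m''))
  m : ℕ
  m = N

  crossAdj : ℕ → ℕ → Bool
  crossAdj X Y = (X <ᵇ m) ∧ ((m ≤ᵇ Y) ∧ (((X + (Y ∸ m)) % m) <ᵇ d))

  crossAdj-fromRight : ∀ X Y → m ≤ X → crossAdj X Y ≡ false
  crossAdj-fromRight X Y m≤X rewrite ≤ᵇ-false {suc X} {m} (s≤s m≤X) = refl

  crossAdj-toLeft : ∀ X Y → Y < m → crossAdj X Y ≡ false
  crossAdj-toLeft X Y Y<m rewrite ≤ᵇ-false {m} {Y} Y<m = ∧-zeroʳ _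

  crossAdj-irrefl : ∀ X → crossAdj X X ≡ false
  crossAdj-irrefl X with X <? m
  ... | yes X<m = crossAdj-toLeft X X X<m
  ... | no X≮m = crossAdj-fromRight X X (≮⇒≥ X≮m)

  crossAdj-value : ∀ X Y → X < m → m ≤ Y → crossAdj X Y ≡ (((X + (Y ∸ m)) % m) <ᵇ d)
  crossAdj-value X Y X<m m≤Y rewrite ≤ᵇ-true X<m | ≤ᵇ-true m≤Y = refl

  crossAdj-right : ∀ X t → X < m → crossAdj X (m + t) ≡ (((X + t) % m) <ᵇ d)
  crossAdj-right X t X<m = trans (crossAdj-value X (m + t) X<m (m≤m+n m t)) (cong (λ z → ((X + z) % m) <ᵇ d) (m+n∸m≡n m t))

  bipAdj : Fin (m + m) → Fin (m + m) → Bool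
  bipAdj x y = crossAdj (toℕ x) (toℕ y) ∨ crossAdj (toℕ y) (toℕ x)

  bipartite : Graph
  bipartite = record
    { n = m + m
    ; adj = bipAdj
    ; sym = λ x y → ∨-comm (crossAdj (toℕ x) (toℕ y)) _
    ; irrefl = λ x → cong₂ _∨_ (crossAdj-irrefl (toℕ x)) (crossAdj-irrefl (toℕ x))
    }

  crossAdj-sides : ∀ X Y → crossAdj X Y ≡ true → ((X <ᵇ m) ≡ true) × ((Y <ᵇ m) ≡ false)
  crossAdj-sides X Y e with X <ᵇ m in X<m | m ≤ᵇ Y in m≤Y
  ... | true | true = refl , ≤ᵇ-false {suc Y} {m} (s≤s (≤ᵇ≡true⇒≤ m Y m≤Y))
  crossAdj-sides X Y () | true | false
  crossAdj-sides X Y () | false | _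

  bipAdj-crosses : ∀ x y → bipAdj x y ≡ true → (toℕ x <ᵇ m) ≡ not (toℕ y <ᵇ m)
  bipAdj-crosses x y e with ∨≡true {crossAdj (toℕ x) (toℕ y)} e
  ... | inj₁ xy = trans (proj₁ s) (cong not (sym (proj₂ s)))
    where s = crossAdj-sides (toℕ x) (toℕ y) xy
  ... | inj₂ yx = trans (proj₂ s) (cong not (sym (proj₁ s)))
    where s = crossAdj-sides (toℕ y) (toℕ x) yx

  triangleFree : TriangleFree bipartite
  triangleFree (a , b , c , ab , bc , ac) = not-¬ {toℕ c <ᵇ m} refl
    (trans (sym (trans (bipAdj-crosses a b ab) (trans (cong not (bipAdj-crosses b c bc)) (not-involutive _))))
           (bipAdj-crosses a c ac))

  module _ (d≤m : d ≤ m) where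
    deg-left : ∀ x → toℕ x < m → deg bipartite x ≡ d
    deg-left x X<m = begin
      countF (m + m) (λ y → crossAdj X (toℕ y) ∨ crossAdj (toℕ y) X)
        ≡⟨ countF-cong (m + m) (λ y → trans (cong (crossAdj X (toℕ y) ∨_) (crossAdj-toLeft (toℕ y) X X<m)) (∨-identityʳ _)) ⟩
      countF (m + m) (λ y → crossAdj X (toℕ y))
        ≡⟨ countF-↑ m m (λ y → crossAdj X (toℕ y)) ⟩
      countF m (λ t → crossAdj X (toℕ (t ↑ˡ m))) + countF m (λ t → crossAdj X (toℕ (m ↑ʳ t)))
        ≡⟨ cong₂ _+_ (countF-false m (λ t → trans (cong (crossAdj X) (FP.toℕ-↑ˡ t m)) (crossAdj-toLeft X (toℕ t) (FP.toℕ<n t))))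
                     (countF-cong m (λ t → trans (cong (crossAdj X) (FP.toℕ-↑ʳ m t)) (crossAdj-right X (toℕ t) X<m))) ⟩
      0 + countF m (λ t → shift X (toℕ t) <ᵇ d)
        ≡⟨ countF-shift (_<ᵇ d) X X<m ⟩
      countF m (λ t → toℕ t <ᵇ d)
        ≡⟨ countF-<ᵇ m d d≤m ⟩
      d ∎
      where
      open ≡-Reasoning
      X = toℕ x

    deg-right : ∀ x → m ≤ toℕ x → deg bipartite x ≡ d
    deg-right x m≤X = begin
      countF (m + m) (λ y → crossAdj X (toℕ y) ∨ crossAdj (toℕ y) X)
        ≡⟨ countF-cong (m + m) (λ y → cong (_∨ crossAdj (toℕ y) X) (crossAdj-fromRight X (toℕ y) m≤X)) ⟩
      countF (m + m) (λ y → crossAdj (toℕ y) X)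
        ≡⟨ countF-↑ m m (λ y → crossAdj (toℕ y) X) ⟩
      countF m (λ t → crossAdj (toℕ (t ↑ˡ m)) X) + countF m (λ t → crossAdj (toℕ (m ↑ʳ t)) X)
        ≡⟨ cong₂ _+_ (countF-cong m (λ t → trans (cong (λ z → crossAdj z X) (FP.toℕ-↑ˡ t m))
                                                (trans (crossAdj-value (toℕ t) X (FP.toℕ<n t) m≤X)
                                                       (cong (λ z → (z % m) <ᵇ d) (+-comm (toℕ t) R)))))
                     (countF-false m (λ t → crossAdj-fromRight _ X (subst (m ≤_) (sym (FP.toℕ-↑ʳ m t)) (m≤m+n m _)))) ⟩
      countF m (λ t → shift R (toℕ t) <ᵇ d) + 0
        ≡⟨ +-identityʳ _ ⟩
      countF m (λ t → shift R (toℕ t) <ᵇ d)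
        ≡⟨ countF-shift (_<ᵇ d) R R<m ⟩
      countF m (λ t → toℕ t <ᵇ d)
        ≡⟨ countF-<ᵇ m d d≤m ⟩
      d ∎
      where
      open ≡-Reasoning
      X = toℕ x
      R = X ∸ m
      R<m : R < m
      R<m = +-cancelʳ-< m R m (subst (_< m + m) (sym (m∸n+n≡m m≤X)) (FP.toℕ<n x))

    deg-bipartite : ∀ x → deg bipartite x ≡ d
    deg-bipartite x with toℕ x <? m
    ... | yes X<m = deg-left x X<m
    ... | no X≮m = deg-right x (≮⇒≥ X≮m)

-- Switching {0, m+1}, {1, 2m-1} to {0, 1}, {m+1, 2m-1} puts 0, 1, m into a triangle.
module BipartiteSwitch (m'' d : ℕ) (2≤d : 2 ≤ d) (d≤m : d ≤ 3 + m'') where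
  open BipartiteCirculant m'' d
  right : Fin m → Fin (m + m)
  right t = m ↑ʳ t
  right-injective : ∀ {s t} → right s ≡ right t → s ≡ t
  right-injective {s} {t} e = FP.toℕ-injective (+-cancelˡ-≡ m (toℕ s) (toℕ t)
    (trans (sym (FP.toℕ-↑ʳ m s)) (trans (cong toℕ e) (FP.toℕ-↑ʳ m t))))
  last : Fin m
  last = fromℕ< (≤-refl {m})
  toℕ-last : toℕ last ≡ suc (suc m'')
  toℕ-last = FP.toℕ-fromℕ< ≤-refl
  m≢m+1 : ¬ _≡_ {A = Fin m} (# 0) (# 1)
  m≢m+1 ()
  m≢2m-1 : ¬ # 0 ≡ last
  m≢2m-1 e = 1+n≢0 (trans (sym toℕ-last) (cong toℕ (sym e)))
  fromLeft : ∀ x y → crossAdj (toℕ x) (toℕ y) ≡ true → bipAdj x y ≡ true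
  fromLeft x y e = cong (_∨ crossAdj (toℕ y) (toℕ x)) e
  toRight : ∀ X t → X < m → crossAdj X (toℕ (right t)) ≡ (((X + toℕ t) % m) <ᵇ d)
  toRight X t X<m = trans (cong (crossAdj X) (FP.toℕ-↑ʳ m t)) (crossAdj-right X (toℕ t) X<m)
  0<d : (0 <ᵇ d) ≡ true
  0<d = ≤ᵇ-true (≤-trans (s≤s z≤n) 2≤d)
  1<d : (1 <ᵇ d) ≡ true
  1<d = ≤ᵇ-true 2≤d
  0~m+1 : bipAdj (# 0) (right (# 1)) ≡ true
  0~m+1 = fromLeft (# 0) (right (# 1)) (trans (toRight 0 (# 1) (s≤s z≤n)) 1<d)
  1~2m-1 : bipAdj (# 1) (right last) ≡ true
  1~2m-1 = fromLeft (# 1) (right last) (trans (toRight 1 last (s≤s (s≤s z≤n)))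
                                              (trans (cong (λ z → ((1 + z) % m) <ᵇ d) toℕ-last) (trans (cong (_<ᵇ d) (n%n≡0 m)) 0<d)))
  0~m : bipAdj (# 0) (right (# 0)) ≡ true
  0~m = fromLeft (# 0) (right (# 0)) (trans (toRight 0 (# 0) (s≤s z≤n)) 0<d)
  1~m : bipAdj (# 1) (right (# 0)) ≡ true
  1~m = fromLeft (# 1) (right (# 0)) (trans (toRight 1 (# 0) (s≤s (s≤s z≤n))) 1<d)
  onRight : ∀ t → m ≤ toℕ (right t)
  onRight t = subst (m ≤_) (sym (FP.toℕ-↑ʳ m t)) (m≤m+n m _)
  m+1≁2m-1 : bipAdj (right (# 1)) (right last) ≡ false
  m+1≁2m-1 = cong₂ _∨_ (crossAdj-fromRight _ (toℕ (right last)) (onRight (# 1)))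
                       (crossAdj-fromRight _ (toℕ (right (# 1))) (onRight last))
  m+1≢2m-1 : ¬ right (# 1) ≡ right last
  m+1≢2m-1 e = 0≢1+n (suc-injective (trans (cong toℕ (right-injective e)) toℕ-last))
  open TwoSwitch bipartite (# 0) (right (# 1)) (# 1) (right last) (λ ()) (λ ()) (λ ()) (λ ()) m+1≢2m-1 (λ ()) 0~m+1 1~2m-1 refl m+1≁2m-1

  pair : NonIsomorphicRegular (3 + m'' + (3 + m'')) d
  pair = record
    { G₁ = switched ; G₂ = bipartite ; size₁ = refl ; size₂ = refl
    ; regular₁ = λ v → trans (deg-switched v) (deg-bipartite d≤m v)
    ; regular₂ = deg-bipartite d≤m
    ; G₁≇G₂ = triangle-≇ switched bipartite
        (switched-triangle (right (# 0)) 0~m 1~m (m≢m+1 ∘ right-injective) (m≢2m-1 ∘ right-injective)) triangleFree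
    }

bipartite-family : ∀ m d → 3 ≤ m → 2 ≤ d → d ≤ m → NonIsomorphicRegular (m + m) d
bipartite-family (suc (suc (suc m''))) d (s≤s (s≤s (s≤s z≤n))) = BipartiteSwitch.pair m'' d

-- Graphs determined by their size and degree

exactlyX : ∀ {bx by} → ℕ → Fm true by → Fm bx by
exactlyX k φ = conj (cntx k φ) (neg (cntx (suc k) φ))

exactlyY : ∀ {bx by} → ℕ → Fm bx true → Fm bx by
exactlyY k φ = conj (cnty k φ) (neg (cnty (suc k) φ))

forallX : ∀ {bx by} → Fm true by → Fm bx by
forallX φ = neg (cntx 1 (neg φ))

-- "there are exactly N vertices and each has exactly D neighbours"
regularSentence : ℕ → ℕ → Sentence
regularSentence N D = conj (exactlyX N (atEq vx vx tt tt)) (forallX (exactlyY D (atE vx vy tt tt)))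

exactly⇒≡ : ∀ k c → (k ≤ᵇ c) ∧ not (suc k ≤ᵇ c) ≡ true → c ≡ k
exactly⇒≡ k c e with k ≤ᵇ c in k≤c | suc k ≤ᵇ c in k<c
... | true | false = ≤-antisym (≮⇒≥ λ c>k → true≢false (trans (sym (≤ᵇ-true c>k)) k<c)) (≤ᵇ≡true⇒≤ k c k≤c)

exactly-refl : ∀ k → (k ≤ᵇ k) ∧ not (suc k ≤ᵇ k) ≡ true
exactly-refl k rewrite ≤ᵇ-true (≤-refl {k}) | ≤ᵇ-false {suc k} {k} (n<1+n k) = refl

⊨-regularSentence : ∀ G N D → G ⊨ regularSentence N D ⇔ ((n G ≡ N) × (∀ v → deg G v ≡ D))
⊨-regularSentence G N D = mk⇔ sound complete
  where
  vertices : countF (n G) (λ w → w ≟ᵇ w) ≡ n G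
  vertices = countF-true (n G) ≟ᵇ-refl
  sound : G ⊨ regularSentence N D → (n G ≡ N) × (∀ v → deg G v ≡ D)
  sound h with Equivalence.to T-∧ h
  ... | sizeN , allD = trans (sym vertices) (exactly⇒≡ N _ (Equivalence.to T-≡ sizeN)) , degD
    where
    noCounterexample : ∀ c → T (not (1 ≤ᵇ c)) → c ≡ 0
    noCounterexample zero _ = refl
    hasDegreeD : ∀ v → eval G (exactlyY D (atE vx vy tt tt)) (v , tt) ≡ true
    hasDegreeD v = trans (sym (not-involutive _)) (cong not (countF≡0⇒false (n G) _ (noCounterexample _ allD) v))
    degD : ∀ v → deg G v ≡ D
    degD v = exactly⇒≡ D (deg G v) (hasDegreeD v)
  complete : (n G ≡ N) × (∀ v → deg G v ≡ D) → G ⊨ regularSentence N D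
  complete (refl , regular) = Equivalence.from T-≡ (cong₂ _∧_
    (trans (cong (λ c → (n G ≤ᵇ c) ∧ not (suc (n G) ≤ᵇ c)) vertices) (exactly-refl (n G)))
    (cong (λ c → not (1 ≤ᵇ c)) (countF-false (n G) (λ v → cong not
      (trans (cong (λ c → (D ≤ᵇ c) ∧ not (suc D ≤ᵇ c)) (regular v)) (exactly-refl D))))))

unique⇒identified : (G : Graph) (d : ℕ) → (∀ v → deg G v ≡ d) →
  (∀ H → n H ≡ n G → (∀ v → deg H v ≡ d) → Iso G H) → IdentifiedC2 G
unique⇒identified G d regular unique =
  regularSentence (n G) d , Equivalence.from (⊨-regularSentence G (n G) d) (refl , regular) ,
  λ H H⊨ → let size , regularH = Equivalence.to (⊨-regularSentence H (n G) d) H⊨ in unique H size regularH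

edgeless-identified : (G : Graph) → NoEdges G → IdentifiedC2 G
edgeless-identified G noEdges = unique⇒identified G 0 (λ v → countF-false (n G) (noEdges v))
  λ H size empty → cast-id (sym size) , λ i j → trans (noEdges i j) (sym (countF≡0⇒false (n H) (adj H _) (empty _) _))

transpose-≢ : ∀ {m} {i j k : Fin m} → ¬ k ≡ i → ¬ k ≡ j → PC.transpose i j k ≡ k
transpose-≢ {i = i} {j} {k} k≢i k≢j rewrite dec-false (k F.≟ i) k≢i | dec-false (k F.≟ j) k≢j = refl

transpose-ʳ : ∀ {m} (i j : Fin m) → PC.transpose i j j ≡ i
transpose-ʳ i j with j F.≟ i
... | yes refl = refl
... | no _ rewrite dec-true (j F.≟ j) refl = refl

-- The perfect matching {0,1}, {2,3}, … (a last vertex of odd m stays unmatched).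
matchingAdj : (m : ℕ) → Fin m → Fin m → Bool
matchingAdj (suc (suc m)) 0F 1F = true
matchingAdj (suc (suc m)) 1F 0F = true
matchingAdj (suc (suc m)) (fs (fs i)) (fs (fs j)) = matchingAdj m i j
matchingAdj _ _ _ = false

matchingAdj-sym : ∀ m i j → matchingAdj m i j ≡ matchingAdj m j i
matchingAdj-sym (suc (suc m)) 0F 0F = refl
matchingAdj-sym (suc (suc m)) 0F 1F = refl
matchingAdj-sym (suc (suc m)) 0F (fs (fs _)) = refl
matchingAdj-sym (suc (suc m)) 1F 0F = refl
matchingAdj-sym (suc (suc m)) 1F 1F = refl
matchingAdj-sym (suc (suc m)) 1F (fs (fs _)) = refl
matchingAdj-sym (suc (suc m)) (fs (fs _)) 0F = refl
matchingAdj-sym (suc (suc m)) (fs (fs _)) 1F = refl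
matchingAdj-sym (suc (suc m)) (fs (fs i)) (fs (fs j)) = matchingAdj-sym m i j
matchingAdj-sym (suc zero) 0F 0F = refl

matchingAdj-irrefl : ∀ m i → matchingAdj m i i ≡ false
matchingAdj-irrefl (suc (suc m)) 0F = refl
matchingAdj-irrefl (suc (suc m)) 1F = refl
matchingAdj-irrefl (suc (suc m)) (fs (fs i)) = matchingAdj-irrefl m i
matchingAdj-irrefl (suc zero) 0F = refl

standardMatching : ℕ → Graph
standardMatching m = record { n = m ; adj = matchingAdj m ; sym = matchingAdj-sym m ; irrefl = matchingAdj-irrefl m }

-- Move a partner u of 0 to position 1, then recurse on the vertices from 2 on.
perfectMatching≅standard : ∀ m (a : Fin m → Fin m → Bool) → (∀ i j → a i j ≡ a j i) → (∀ i → a i i ≡ false) →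
  (∀ v → countF m (a v) ≡ 1) → Σ (Permutation m m) λ π → ∀ i j → a i j ≡ matchingAdj m (π ⟨$⟩ʳ i) (π ⟨$⟩ʳ j)
perfectMatching≅standard zero a _ _ _ = Perm.id , λ ()
perfectMatching≅standard (suc zero) a _ a-irrefl deg1 = ⊥-elim (0≢1+n (trans (sym (cong (λ b → 𝟙 b + 0) (a-irrefl 0F))) (deg1 0F)))
perfectMatching≅standard (suc (suc m)) a a-sym a-irrefl deg1 = τ ∘ₚ lift₀ (lift₀ π) , λ i j →
  trans (sym (cong₂ a (inverseˡ τ) (inverseˡ τ))) (a'≅ (τ ⟨$⟩ʳ i) (τ ⟨$⟩ʳ j))
  where
  partner = countF>0⇒∃ (suc (suc m)) (a 0F) (subst (0 <_) (sym (deg1 0F)) (s≤s z≤n))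
  u = proj₁ partner
  0≢u : ¬ 0F ≡ u
  0≢u 0≡u = true≢false (trans (sym (proj₂ partner)) (trans (cong (a 0F) (sym 0≡u)) (a-irrefl 0F)))
  τ = transpose 1F u
  a' : Fin (suc (suc m)) → Fin (suc (suc m)) → Bool
  a' i j = a (τ ⟨$⟩ˡ i) (τ ⟨$⟩ˡ j)
  τ0 : τ ⟨$⟩ˡ 0F ≡ 0F
  τ0 = transpose-≢ 0≢u (λ ())
  a'01 : a' 0F 1F ≡ true
  a'01 = trans (cong₂ a τ0 (transpose-ʳ u 1F)) (proj₂ partner)
  a'10 : a' 1F 0F ≡ true
  a'10 = trans (a-sym _ _) a'01
  deg1' : ∀ v → countF (suc (suc m)) (a' v) ≡ 1
  deg1' v = trans (countF-perm _ _ (flip τ) (a (τ ⟨$⟩ˡ v))) (deg1 (τ ⟨$⟩ˡ v))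
  1≢2+ : ∀ {j : Fin m} → ¬ _≡_ {A = Fin (suc (suc m))} 1F (fs (fs j))
  1≢2+ ()
  0≢2+ : ∀ {j : Fin m} → ¬ _≡_ {A = Fin (suc (suc m))} 0F (fs (fs j))
  0≢2+ ()
  0≁ : ∀ j → a' 0F (fs (fs j)) ≡ false
  0≁ j = ¬-not (λ e → 1≢2+ (countF≡1⇒unique _ (a' 0F) (deg1' 0F) 1F (fs (fs j)) a'01 e))
  1≁ : ∀ j → a' 1F (fs (fs j)) ≡ false
  1≁ j = ¬-not (λ e → 0≢2+ (countF≡1⇒unique _ (a' 1F) (deg1' 1F) 0F (fs (fs j)) a'10 e))
  a'' : Fin m → Fin m → Bool
  a'' i j = a' (fs (fs i)) (fs (fs j))
  deg1'' : ∀ v → countF m (a'' v) ≡ 1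
  deg1'' v = trans (sym (cong₂ (λ x y → 𝟙 x + (𝟙 y + countF m (a'' v))) (trans (a-sym _ _) (0≁ v)) (trans (a-sym _ _) (1≁ v))))
                   (deg1' (fs (fs v)))
  IH = perfectMatching≅standard m a'' (λ i j → a-sym _ _) (λ i → a-irrefl _) deg1''
  π = proj₁ IH
  a'≅ : ∀ i j → a' i j ≡ matchingAdj (suc (suc m)) (lift₀ (lift₀ π) ⟨$⟩ʳ i) (lift₀ (lift₀ π) ⟨$⟩ʳ j)
  a'≅ 0F 0F = a-irrefl _
  a'≅ 0F 1F = a'01
  a'≅ 0F (fs (fs j)) = 0≁ j
  a'≅ 1F 0F = a'10
  a'≅ 1F 1F = a-irrefl _
  a'≅ 1F (fs (fs j)) = 1≁ j
  a'≅ (fs (fs i)) 0F = trans (a-sym _ _) (0≁ i)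
  a'≅ (fs (fs i)) 1F = trans (a-sym _ _) (1≁ i)
  a'≅ (fs (fs i)) (fs (fs j)) = proj₂ IH i j

matching-identified : (G : Graph) → PerfectMatching G → IdentifiedC2 G
matching-identified G matching = unique⇒identified G 1 matching λ H size matchingH →
  Iso-trans G (standardMatching (n G)) H (≅standard G matching)
    (Iso-sym H (standardMatching (n G)) (subst (λ m → Iso H (standardMatching m)) size (≅standard H matchingH)))
  where
  ≅standard : (K : Graph) → PerfectMatching K → Iso K (standardMatching (n K))
  ≅standard K = perfectMatching≅standard (n K) (adj K) (adj-sym K) (irrefl K)

allVec? : ∀ k {P : Vec Bool k → Set} → (∀ v → Dec (P v)) → Dec (∀ v → P v)
allVec? zero    P? = map′ (λ { p [] → p }) (λ h → h []) (P? [])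
allVec? (suc k) P? = map′ (λ { (t , f) (true ∷ v) → t v ; (t , f) (false ∷ v) → f v })
                          (λ h → h ∘ (true ∷_) , h ∘ (false ∷_))
                          (allVec? k (P? ∘ (true ∷_)) ×-dec allVec? k (P? ∘ (false ∷_)))

pairs : Vec (Fin 5 × Fin 5) 10
pairs = (0F , 1F) ∷ (0F , 2F) ∷ (0F , 3F) ∷ (0F , 4F) ∷ (1F , 2F) ∷ (1F , 3F) ∷ (1F , 4F) ∷ (2F , 3F) ∷ (2F , 4F) ∷ (3F , 4F) ∷ []

-- Bit k of the vector says whether the k-th entry of pairs is an edge.
fromBits : Vec Bool 10 → Fin 5 → Fin 5 → Bool
fromBits bits i j = go pairs bits
  where
  go : ∀ {k} → Vec (Fin 5 × Fin 5) k → Vec Bool k → Bool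
  go []              []       = false
  go ((p , q) ∷ ps) (b ∷ bs) = if ((i ≟ᵇ p) ∧ (j ≟ᵇ q)) ∨ ((i ≟ᵇ q) ∧ (j ≟ᵇ p)) then b else go ps bs

bits : (Fin 5 → Fin 5 → Bool) → Vec Bool 10
bits a = Vec.map (λ (p , q) → a p q) pairs

fromBits-bits : ∀ (a : Fin 5 → Fin 5 → Bool) → (∀ i j → a i j ≡ a j i) → (∀ i → a i i ≡ false) →
  ∀ i j → a i j ≡ fromBits (bits a) i j
fromBits-bits a s ir 0F 0F = ir 0F
fromBits-bits a s ir 0F 1F = refl
fromBits-bits a s ir 0F 2F = refl
fromBits-bits a s ir 0F 3F = refl
fromBits-bits a s ir 0F 4F = refl
fromBits-bits a s ir 1F 0F = s 1F 0F
fromBits-bits a s ir 1F 1F = ir 1F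
fromBits-bits a s ir 1F 2F = refl
fromBits-bits a s ir 1F 3F = refl
fromBits-bits a s ir 1F 4F = refl
fromBits-bits a s ir 2F 0F = s 2F 0F
fromBits-bits a s ir 2F 1F = s 2F 1F
fromBits-bits a s ir 2F 2F = ir 2F
fromBits-bits a s ir 2F 3F = refl
fromBits-bits a s ir 2F 4F = refl
fromBits-bits a s ir 3F 0F = s 3F 0F
fromBits-bits a s ir 3F 1F = s 3F 1F
fromBits-bits a s ir 3F 2F = s 3F 2F
fromBits-bits a s ir 3F 3F = ir 3F
fromBits-bits a s ir 3F 4F = refl
fromBits-bits a s ir 4F 0F = s 4F 0F
fromBits-bits a s ir 4F 1F = s 4F 1F
fromBits-bits a s ir 4F 2F = s 4F 2F
fromBits-bits a s ir 4F 3F = s 4F 3F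
fromBits-bits a s ir 4F 4F = ir 4F

firstTrue : ∀ {n} → (Fin (suc n) → Bool) → Fin (suc n)
firstTrue {zero}  p = fz
firstTrue {suc n} p = if p fz then fz else fs (firstTrue (p ∘ fs))

-- In a 2-regular graph on Fin 5, walking from 0 without stepping back lists the vertices in cycle order.
module Walk (a : Fin 5 → Fin 5 → Bool) where

  next : Fin 5 → Fin 5 → Fin 5
  next u v = firstTrue (λ w → a v w ∧ not (w ≟ᵇ u))

  walk : Fin 5 → Fin 5
  walk = lookup (v₀ ∷ v₁ ∷ v₂ ∷ v₃ ∷ v₄ ∷ [])
    where
    v₀ = 0F
    v₁ = next v₀ v₀
    v₂ = next v₀ v₁
    v₃ = next v₁ v₂
    v₄ = next v₂ v₃

  position : Fin 5 → Fin 5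
  position v = firstTrue (λ i → walk i ≟ᵇ v)

  Deg2 : Set
  Deg2 = ∀ v → countF 5 (a v) ≡ 2

  deg2? : Dec Deg2
  deg2? = FP.all? (λ v → countF 5 (a v) ℕ.≟ 2)

  WalkIso : Set
  WalkIso = (∀ i → position (walk i) ≡ i) × (∀ v → walk (position v) ≡ v) ×
            (∀ v w → a v w ≡ adj C5 (position v) (position w))

  walkIso? : Dec WalkIso
  walkIso? = FP.all? (λ i → position (walk i) F.≟ i) ×-dec FP.all? (λ v → walk (position v) F.≟ v) ×-dec
             FP.all? (λ v → FP.all? (λ w → a v w Bool.≟ adj C5 (position v) (position w)))

-- Decided by evaluation over all 2¹⁰ graphs on Fin 5.
C5-table : ∀ bs → Walk.Deg2 (fromBits bs) → Walk.WalkIso (fromBits bs)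
C5-table = toWitness {a? = allVec? 10 (λ bs → Walk.deg2? (fromBits bs) →-dec Walk.walkIso? (fromBits bs))} _

C5-unique : (H : Graph) → n H ≡ 5 → (∀ v → deg H v ≡ 2) → Iso H C5
C5-unique H n≡5 regular = onFin5 (n H) n≡5 (adj H) (adj-sym H) (irrefl H) regular
  where
  onFin5 : ∀ m → m ≡ 5 → (a : Fin m → Fin m → Bool) → (∀ i j → a i j ≡ a j i) → (∀ i → a i i ≡ false) →
    (∀ v → countF m (a v) ≡ 2) → Σ (Permutation m 5) λ π → ∀ i j → a i j ≡ adj C5 (π ⟨$⟩ʳ i) (π ⟨$⟩ʳ j)
  onFin5 .5 refl a a-sym a-irrefl deg2 = permutation position walk position-walk walk-position , λ i j → trans (a≗ i j) (preserves i j)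
    where
    a≗ = fromBits-bits a a-sym a-irrefl
    open Walk (fromBits (bits a))
    table = C5-table (bits a) (λ v → trans (countF-cong 5 (λ w → sym (a≗ v w))) (deg2 v))
    position-walk = proj₁ table
    walk-position = proj₁ (proj₂ table)
    preserves = proj₂ (proj₂ table)

C5-regular : ∀ v → deg C5 v ≡ 2
C5-regular 0F = refl
C5-regular 1F = refl
C5-regular 2F = refl
C5-regular 3F = refl
C5-regular 4F = refl

C5-identified : (G : Graph) → Iso G C5 → IdentifiedC2 G
C5-identified G G≅C5 = unique⇒identified G 2 regular λ H size regularH →
  Iso-trans G C5 H G≅C5 (Iso-sym H C5 (C5-unique H (trans size (Iso⇒n≡ G C5 G≅C5)) regularH))
  where
  regular : ∀ v → deg G v ≡ 2
  regular v = trans (Iso⇒deg≡ G C5 G≅C5 v) (C5-regular (proj₁ G≅C5 ⟨$⟩ʳ v))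

nonIsomorphicRegular : ∀ N d → 2 ≤ d → suc (d + d) ≤ N → (∃ λ e → N * d ≡ e + e) → ¬ (N ≡ 5 × d ≡ 2) →
  NonIsomorphicRegular N d
nonIsomorphicRegular N d 2≤d 2d<N (e , N*d≡e+e) not-C5 with parity N
... | even m = bipartite-family m d (≤-trans (s≤s 2≤d) d<m) 2≤d (<⇒≤ d<m)
  where
  d<m : d < m
  d<m = ≰⇒> λ m≤d → <⇒≱ 2d<N (+-mono-≤ m≤d m≤d)
... | odd p with parity d
...   | odd q = ⊥-elim (odd*odd≢even p q e N*d≡e+e)
...   | even (suc zero) = cycle-family N (≤∧≢⇒< 2d<N λ 5≡N → not-C5 (sym 5≡N , refl))
...   | even (suc (suc q)) = circulant-family (suc (suc q)) N (s≤s (s≤s z≤n)) (subst (λ x → suc x ≤ N) (sym (+-assoc (k + k) k k)) 2d<N)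
  where k = suc (suc q)

zero⊎Fin : ∀ m → (m ≡ 0) ⊎ Fin m
zero⊎Fin zero    = inj₁ refl
zero⊎Fin (suc m) = inj₂ fz

identified⇒classified : (G : Graph) (d : ℕ) → (∀ v → deg G v ≡ d) → Flipped G → IdentifiedC2 G →
  NoEdges G ⊎ PerfectMatching G ⊎ Iso G C5
identified⇒classified G zero          regular _ _ = inj₁ λ v → countF≡0⇒false (n G) (adj G v) (regular v)
identified⇒classified G (suc zero)    regular _ _ = inj₂ (inj₁ regular)
identified⇒classified G d@(suc (suc _)) regular flipped idG with zero⊎Fin (n G) | (n G ℕ.≟ 5) ×-dec (d ℕ.≟ 2)
... | inj₁ n≡0 | _ = inj₁ λ v → ⊥-elim (FP.¬Fin0 (subst Fin n≡0 v))
... | inj₂ _ | yes (n≡5 , refl) = inj₂ (inj₂ (identified-regular-unique idG regular C5 n≡5 C5-regular))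
... | inj₂ v | no not-C5 = ⊥-elim (identified⇒¬NonIsomorphicRegular idG regular
      (nonIsomorphicRegular (n G) d (s≤s (s≤s z≤n)) (flipped⇒2d<n G d regular flipped v)
                            (countPairs (n G) (adj G) , degree-sum G d regular) not-C5))

lemma4p5 : (G : Graph) → Regular G → Flipped G →
    (IdentifiedC2 G ⇔ (NoEdges G ⊎ PerfectMatching G ⊎ Iso G C5))
lemma4p5 G (d , regular) flipped =
  mk⇔ (identified⇒classified G d regular flipped)
      [ edgeless-identified G , [ matching-identified G , C5-identified G ] ]
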